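{- Let $\mathbb{K}$ be a field of characteristic $0$ and $\mathcal{H}$ the $\mathbb{K}$-vector space freely spanned by totally assigned graphs (TAGs), with product $m\big((\Gamma_1,\mu_1),(\Gamma_2,\mu_2)\big)=(\Gamma_1\sqcup\Gamma_2,\mu_1\sqcup\mu_2)$, unit $1_{\mathcal{H}}$ the empty graph, coproduct $\Delta\big((\Gamma,\mu)\big)=\sum_{\emptyset\subseteq(\gamma,\nu)\subseteq(\Gamma,\mu)}(\gamma,\nu)\otimes(\Gamma/\gamma,\mu/\nu)$, and counit $\epsilon$ with $\epsilon(1_{\mathcal{H}})=1$ and $\epsilon\big((\Gamma,\mu)\big)=0$ for every TAG $(\Gamma,\mu)\neq 1_{\mathcal{H}}$. Then $(\mathcal{H},m,1_{\mathcal{H}},\Delta,\epsilon)$ is a bialgebra.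
   Context: Graphs are finite, possibly disconnected, with loops and multiple edges allowed; $E(\Gamma)$ is the edge set. A TAG is a pair $(\Gamma,\mu)$ where $\mu$ is a total order on $E(\Gamma)$. $\mu_1\sqcup\mu_2$ is the ordinal sum order on $E(\Gamma_1)\sqcup E(\Gamma_2)$: it restricts to $\mu_i$ on $E(\Gamma_i)$ and every edge of $\Gamma_1$ precedes every edge of $\Gamma_2$. A subgraph $\gamma$ of $\Gamma$ is formed by a subset of $E(\Gamma)$ together with the vertices incident to these edges; a totally assigned subgraph $(\gamma,\nu)$ carries $\nu=\mu|_{E(\gamma)}$. The shrinking $(\Gamma/\gamma,\mu/\nu)$: contract each connected component of $\gamma$ to a point, and restrict $\mu$ to the edges of $\Gamma$ not in $\gamma$. -}

module Defs where

open import Level using (_⊔_)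
open import Algebra.Bundles using (CommutativeRing)
open import Data.Nat as ℕ using (ℕ; zero; suc)
open import Data.Bool using (Bool; if_then_else_)
open import Data.Product using (_×_; _,_; ∃₂; Σ)
open import Data.Sum using (_⊎_)
open import Data.List using (List; []; _∷_; _++_; map; foldr; foldl; concatMap)
open import Data.List.Relation.Binary.Pointwise using (Pointwise)
open import Relation.Binary.PropositionalEquality using (_≡_)
open import Relation.Nullary using (¬_)

-- A TAG (Γ, μ) is represented by the list of its edges written in the
-- order μ; an edge is the (unordered) pair of its end-vertices, vertices
-- being labelled by natural numbers.  Loops (u , u) and multiple edges
-- are allowed.  The vertex set is the set of labels incident to edges
--.

Edge : Set
Edge = ℕ × ℕ

TAG : Set
TAG = List Edge

EdgeTo : (ℕ → ℕ) → Edge → Edge → Set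
EdgeTo f (u , v) (u' , v') = (f u ≡ u' × f v ≡ v') ⊎ (f u ≡ v' × f v ≡ u')

-- Isomorphism of TAGs: an isomorphism of graphs preserving the total
-- orders, i.e. vertex maps f, g sending the i-th edge of one to the
-- i-th edge of the other (this forces f to be a bijection between the
-- vertex sets, with inverse g on them).
_≅_ : TAG → TAG → Set
Γ ≅ Γ' = ∃₂ λ (f g : ℕ → ℕ) → Pointwise (EdgeTo f) Γ Γ' × Pointwise (EdgeTo g) Γ' Γ

-- Disjoint union with ordinal-sum order: edges of Γ₁ first, then those of
-- Γ₂ with their vertices relabelled away from the vertices of Γ₁.
bound : TAG → ℕ
bound = foldr (λ { (u , v) n → suc u ℕ.⊔ suc v ℕ.⊔ n }) 0

shift : ℕ → TAG → TAG
shift n = map (λ { (u , v) → (n ℕ.+ u , n ℕ.+ v) })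

_⊔ᵀ_ : TAG → TAG → TAG
Γ₁ ⊔ᵀ Γ₂ = Γ₁ ++ shift (bound Γ₁) Γ₂

-- All subgraphs (γ , ν): each subset of the edge set, returned as the
-- pair (edges of γ in the order μ , remaining edges in the order μ).
selections : TAG → List (TAG × TAG)
selections [] = ([] , []) ∷ []
selections (e ∷ Γ) =
  map (λ { (s , r) → (e ∷ s , r) }) (selections Γ) ++
  map (λ { (s , r) → (s , e ∷ r) }) (selections Γ)

-- rep γ x : a representative of the connected component of x in γ
-- (successively merging the classes of the two ends of each edge of γ);
-- vertices not in γ are their own representative.
rep : TAG → ℕ → ℕ
rep γ = foldl step (λ x → x) γ
  where
  step : (ℕ → ℕ) → Edge → ℕ → ℕ
  step r (u , v) x = if r x ℕ.≡ᵇ r v then r u else r x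

-- Shrinking Γ/γ: contract each connected component of γ to a point and
-- keep the remaining edges with the restricted order.
contract : TAG → TAG → TAG
contract γ rest = map (λ { (u , v) → (rep γ u , rep γ v) }) rest

module _ {c ℓ} (K : CommutativeRing c ℓ) where
  open CommutativeRing K

  IsField : Set (c ⊔ ℓ)
  IsField = ¬ (1# ≈ 0#) × (∀ x → ¬ (x ≈ 0#) → Σ Carrier λ y → x * y ≈ 1#)

  natK : ℕ → Carrier
  natK zero = 0#
  natK (suc n) = 1# + natK n

  CharZero : Set ℓ
  CharZero = ∀ n → ¬ (natK (suc n) ≈ 0#)

module TAGAlgebra {c ℓ} (K : CommutativeRing c ℓ) where
  open CommutativeRing K

  FS : Set → Set c
  FS B = List (Carrier × B)

  -- The K-vector space freely spanned by B modulo the identification of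
  -- R-related basis elements: the congruence generated by reordering,
  -- collecting like terms, dropping zero terms and R.
  data Eqv {B : Set} (R : B → B → Set) : FS B → FS B → Set (c ⊔ ℓ) where
    refl′  : ∀ {xs} → Eqv R xs xs
    sym′   : ∀ {xs ys} → Eqv R xs ys → Eqv R ys xs
    trans′ : ∀ {xs ys zs} → Eqv R xs ys → Eqv R ys zs → Eqv R xs zs
    cons′  : ∀ {a a' b b' xs ys} → a ≈ a' → R b b' → Eqv R xs ys →
             Eqv R ((a , b) ∷ xs) ((a' , b') ∷ ys)
    swap′  : ∀ {t u xs} → Eqv R (t ∷ u ∷ xs) (u ∷ t ∷ xs)
    merge′ : ∀ {a a' b xs} → Eqv R ((a , b) ∷ (a' , b) ∷ xs) ((a + a' , b) ∷ xs)
    zero′  : ∀ {b xs} → Eqv R ((0# , b) ∷ xs) xs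

  R₁ : TAG → TAG → Set
  R₁ = _≅_

  R₂ : TAG × TAG → TAG × TAG → Set
  R₂ (a , b) (a' , b') = (a ≅ a') × (b ≅ b')

  R₃ : TAG × (TAG × TAG) → TAG × (TAG × TAG) → Set
  R₃ (a , p) (a' , p') = (a ≅ a') × R₂ p p'

  H : Set c
  H = FS TAG

  H⊗H : Set c
  H⊗H = FS (TAG × TAG)

  H⊗H⊗H : Set c
  H⊗H⊗H = FS (TAG × (TAG × TAG))

  _∼₁_ : H → H → Set (c ⊔ ℓ)
  _∼₁_ = Eqv R₁

  _∼₂_ : H⊗H → H⊗H → Set (c ⊔ ℓ)
  _∼₂_ = Eqv R₂

  _∼₃_ : H⊗H⊗H → H⊗H⊗H → Set (c ⊔ ℓ)
  _∼₃_ = Eqv R₃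

  scale : ∀ {B} → Carrier → FS B → FS B
  scale k = map (λ { (a , b) → (k * a , b) })

  ext : ∀ {B C} → (B → FS C) → FS B → FS C
  ext f [] = []
  ext f ((k , b) ∷ xs) = scale k (f b) ++ ext f xs

  bilin : ∀ {B C D} → (B → C → D) → FS B → FS C → FS D
  bilin f xs ys = concatMap (λ { (a , b) → map (λ { (a' , b') → (a * a' , f b b') }) ys }) xs

  m : H → H → H
  m = bilin _⊔ᵀ_

  1H : H
  1H = (1# , []) ∷ []

  Δᵇ : TAG → H⊗H
  Δᵇ Γ = map (λ { (γ , rest) → (1# , (γ , contract γ rest)) }) (selections Γ)

  Δ : H → H⊗H
  Δ = ext Δᵇ

  εᵇ : TAG → Carrier
  εᵇ [] = 1#
  εᵇ (_ ∷ _) = 0#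

  ε : H → Carrier
  ε = foldr (λ { (a , Γ) s → a * εᵇ Γ + s }) 0#

  m₂ : H⊗H → H⊗H → H⊗H
  m₂ = bilin (λ { (a , b) (a' , b') → (a ⊔ᵀ a' , b ⊔ᵀ b') })

  1H⊗1H : H⊗H
  1H⊗1H = (1# , ([] , [])) ∷ []

  Δ⊗id : H⊗H → H⊗H⊗H
  Δ⊗id = ext (λ { (Γ₁ , Γ₂) → map (λ { (a , (x , y)) → (a , (x , (y , Γ₂))) }) (Δᵇ Γ₁) })

  id⊗Δ : H⊗H → H⊗H⊗H
  id⊗Δ = ext (λ { (Γ₁ , Γ₂) → map (λ { (a , p) → (a , (Γ₁ , p)) }) (Δᵇ Γ₂) })

  -- (ε ⊗ id) and (id ⊗ ε), composed with K ⊗ H ≅ H ≅ H ⊗ K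
  ε⊗id : H⊗H → H
  ε⊗id = map (λ { (a , (Γ₁ , Γ₂)) → (a * εᵇ Γ₁ , Γ₂) })

  id⊗ε : H⊗H → H
  id⊗ε = map (λ { (a , (Γ₁ , Γ₂)) → (a * εᵇ Γ₂ , Γ₁) })

  record IsBialgebra : Set (c ⊔ ℓ) where
    field
      m-cong   : ∀ {x x' y y'} → x ∼₁ x' → y ∼₁ y' → m x y ∼₁ m x' y'
      Δ-cong   : ∀ {x x'} → x ∼₁ x' → Δ x ∼₂ Δ x'
      ε-cong   : ∀ {x x'} → x ∼₁ x' → ε x ≈ ε x'
      m-assoc  : ∀ x y z → m (m x y) z ∼₁ m x (m y z)
      m-unitˡ  : ∀ x → m 1H x ∼₁ x
      m-unitʳ  : ∀ x → m x 1H ∼₁ x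
      Δ-coassoc : ∀ x → Δ⊗id (Δ x) ∼₃ id⊗Δ (Δ x)
      counitˡ  : ∀ x → ε⊗id (Δ x) ∼₁ x
      counitʳ  : ∀ x → id⊗ε (Δ x) ∼₁ x
      Δ-mult   : ∀ x y → Δ (m x y) ∼₂ m₂ (Δ x) (Δ y)
      Δ-unit   : Δ 1H ∼₂ 1H⊗1H
      ε-mult   : ∀ x y → ε (m x y) ≈ ε x * ε y
      ε-unit   : ε 1H ≈ 1#

-- An element of H is a list of coefficient–TAG pairs taken up to Eqv, so every law reduces by
-- linearity to a statement about single TAGs up to isomorphism, i.e. up to relabelling vertices.
--
-- Δ is multiplicative because a subgraph of Γ₁ ⊔ Γ₂ is a pair of subgraphs, and shrinking a
-- disjoint union shrinks each part separately: the representative chosen by rep never leaves the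
-- vertex range of the part it lies in. The counit laws hold because (∅, Γ) and (Γ, ∅) are the only
-- selections with an empty side. For coassociativity, both (Δ ⊗ id) Δ Γ and (id ⊗ Δ) Δ Γ run,
-- in different orders, over the ways of splitting the edges of Γ into three parts A, B, C, with
-- terms A ⊗ (A ∪ B)/A ⊗ Γ/(A ∪ B) and A ⊗ (A ∪ B)/A ⊗ (Γ/A)/((A ∪ B)/A) respectively. These agree
-- because contracting the components of A ∪ B is the same as first contracting A and then the
-- image of B.

module Submission where

open import Defs
open import Algebra.Bundles using (CommutativeRing)
open import Relation.Binary.Bundles using (Setoid)
import Relation.Binary.Reasoning.Setoid
open import Level using (Level)
open import Data.Bool using (Bool; true; false; if_then_else_)
open import Data.Bool.Properties using (T-≡)
open import Data.Empty using (⊥-elim)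
open import Data.List using (List; []; _∷_; _++_; [_]; map; foldl; concatMap; cartesianProductWith; null)
import Data.List.Properties as List
open import Data.List.Membership.Propositional using (_∈_)
open import Data.List.Membership.Propositional.Properties using (∈-++⁺ˡ; ∈-++⁺ʳ; ∈-map⁺; ∈-map⁻)
open import Data.List.Relation.Binary.Permutation.Propositional as ↭ using (_↭_; prep; swap)
import Data.List.Relation.Binary.Permutation.Propositional.Properties as ↭
open import Data.List.Relation.Binary.Pointwise as Pointwise using (Pointwise; []; _∷_)
open import Data.List.Relation.Unary.All as All using (All; []; _∷_)
import Data.List.Relation.Unary.All.Properties as All
open import Data.List.Relation.Unary.Any using (here; there)
open import Data.Nat using (ℕ; zero; suc)
open import Data.Product as Product using (_×_; _,_; proj₁; proj₂; ∃; zip′)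
open import Data.Product.Relation.Binary.Pointwise.NonDependent using () renaming (Pointwise to ×-Pointwise)
open import Data.Sum as Sum using (_⊎_; inj₁; inj₂)
open import Function using (_∘_; id; Equivalence)
open import Relation.Binary.PropositionalEquality as ≡
  using (_≡_; refl; sym; trans; cong; cong₂; subst; subst₂)
open import Relation.Nullary using (yes; no)

private
  variable
    a b c d p r : Level
    A : Set a
    B : Set b
    C : Set c
    D : Set d

map-map : ∀ {f : B → C} {g : A → B} {h : A → C} → (∀ x → f (g x) ≡ h x) → ∀ xs → map f (map g xs) ≡ map h xs
map-map f∘g≗h xs = trans (sym (List.map-∘ xs)) (List.map-cong f∘g≗h xs)

map-++-natural : ∀ {f : B → C} {g h : A → B} {f' : A → D} {g' h' : D → C} →
  (∀ x → f (g x) ≡ g' (f' x)) → (∀ x → f (h x) ≡ h' (f' x)) → ∀ xs →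
  map f (map g xs ++ map h xs) ≡ map g' (map f' xs) ++ map h' (map f' xs)
map-++-natural fg≗g'f' fh≗h'f' xs =
  trans (List.map-++ _ (map _ xs) _)
        (cong₂ _++_ (trans (map-map fg≗g'f' xs) (sym (map-map (λ _ → refl) xs)))
                    (trans (map-map fh≗h'f' xs) (sym (map-map (λ _ → refl) xs))))

null-map : ∀ (f : A → B) xs → null (map f xs) ≡ null xs
null-map f [] = refl
null-map f (_ ∷ _) = refl

map-cartesianProductWith : ∀ (h : C → D) (f : A → B → C) xs ys →
  map h (cartesianProductWith f xs ys) ≡ cartesianProductWith (λ x y → h (f x y)) xs ys
map-cartesianProductWith h f [] ys = refl
map-cartesianProductWith h f (x ∷ xs) ys =
  trans (List.map-++ h (map (f x) ys) _) (cong₂ _++_ (map-map (λ _ → refl) ys) (map-cartesianProductWith h f xs ys))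

cartesianProductWith-mapˡ : ∀ (f : A → B → C) (g : D → A) xs ys →
  cartesianProductWith f (map g xs) ys ≡ cartesianProductWith (λ x y → f (g x) y) xs ys
cartesianProductWith-mapˡ f g [] ys = refl
cartesianProductWith-mapˡ f g (x ∷ xs) ys = cong (map (f (g x)) ys ++_) (cartesianProductWith-mapˡ f g xs ys)

cartesianProductWith-mapʳ : ∀ (f : A → B → C) (g : D → B) xs ys →
  cartesianProductWith f xs (map g ys) ≡ cartesianProductWith (λ x y → f x (g y)) xs ys
cartesianProductWith-mapʳ f g [] ys = refl
cartesianProductWith-mapʳ f g (x ∷ xs) ys = cong₂ _++_ (map-map (λ _ → refl) ys) (cartesianProductWith-mapʳ f g xs ys)

cartesianProductWith-pointwise : ∀ {P : A → Set p} {R : C → D → Set r} (f : A → B → C) (g : A → B → D) {xs} ys →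
  All P xs → (∀ {x} → P x → ∀ y → R (f x y) (g x y)) →
  Pointwise R (cartesianProductWith f xs ys) (cartesianProductWith g xs ys)
cartesianProductWith-pointwise f g ys [] R-fg = []
cartesianProductWith-pointwise f g ys (px ∷ pxs) R-fg =
  Pointwise.++⁺ (Pointwise.map⁺ _ _ (Pointwise.refl (λ {y} → R-fg px y))) (cartesianProductWith-pointwise f g ys pxs R-fg)

Pointwise-zip : ∀ {R : A → B → Set r} {S : A → B → Set p} {xs ys} →
                Pointwise R xs ys → Pointwise S xs ys → Pointwise (λ x y → R x y × S x y) xs ys
Pointwise-zip [] [] = []
Pointwise-zip (r ∷ rs) (s ∷ ss) = (r , s) ∷ Pointwise-zip rs ss

Pointwise-∈ : ∀ {R : A → B → Set r} {xs ys x} → Pointwise R xs ys → x ∈ xs → ∃ λ y → y ∈ ys × R x y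
Pointwise-∈ (r ∷ rs) (here refl) = _ , here refl , r
Pointwise-∈ (r ∷ rs) (there x∈xs) with Pointwise-∈ rs x∈xs
... | y , y∈ys , r' = y , there y∈ys , r'

concatMap-++-↭ : ∀ (f g : A → List B) xs → concatMap (λ x → f x ++ g x) xs ↭ concatMap f xs ++ concatMap g xs
concatMap-++-↭ f g [] = ↭.refl
concatMap-++-↭ f g (x ∷ xs) = begin
  (f x ++ g x) ++ concatMap (λ x → f x ++ g x) xs   ↭⟨ ↭.++⁺ˡ (f x ++ g x) (concatMap-++-↭ f g xs) ⟩
  (f x ++ g x) ++ concatMap f xs ++ concatMap g xs  ≡⟨ List.++-assoc (f x) (g x) _ ⟩
  f x ++ g x ++ concatMap f xs ++ concatMap g xs    ↭⟨ ↭.++⁺ˡ (f x) (↭.shifts (g x) (concatMap f xs)) ⟩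
  f x ++ concatMap f xs ++ g x ++ concatMap g xs    ≡⟨ List.++-assoc (f x) (concatMap f xs) _ ⟨
  (f x ++ concatMap f xs) ++ g x ++ concatMap g xs  ∎
  where open ↭.PermutationReasoning

concatMap-comm-↭ : ∀ (f : A → B → List C) xs ys →
                   concatMap (λ x → concatMap (f x) ys) xs ↭ concatMap (λ y → concatMap (λ x → f x y) xs) ys
concatMap-comm-↭ f [] ys = ↭.↭-reflexive (sym (nil ys))
  where
  nil : ∀ ys → concatMap (λ y → concatMap (λ x → f x y) []) ys ≡ []
  nil [] = refl
  nil (_ ∷ ys) = nil ys
concatMap-comm-↭ f (x ∷ xs) ys =
  ↭.trans (↭.++⁺ˡ (concatMap (f x) ys) (concatMap-comm-↭ f xs ys)) (↭.↭-sym (concatMap-++-↭ (f x) _ ys))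

module Graphs where

  open import Data.Nat using (_+_; _∸_; _<_; _≤_; _≡ᵇ_; _<?_; _⊔_)
  import Data.Nat.Properties as ℕ

  Relabels : (ℕ → ℕ) → TAG → TAG → Set
  Relabels f = Pointwise (EdgeTo f)

  EdgeTo-id : ∀ {e} → EdgeTo id e e
  EdgeTo-id = inj₁ (refl , refl)

  EdgeTo-∘ : ∀ {f g : ℕ → ℕ} {e e' e''} → EdgeTo f e e' → EdgeTo g e' e'' → EdgeTo (g ∘ f) e e''
  EdgeTo-∘ {g = g} (inj₁ (p , q)) (inj₁ (r , s)) = inj₁ (trans (cong g p) r , trans (cong g q) s)
  EdgeTo-∘ {g = g} (inj₁ (p , q)) (inj₂ (r , s)) = inj₂ (trans (cong g p) r , trans (cong g q) s)
  EdgeTo-∘ {g = g} (inj₂ (p , q)) (inj₁ (r , s)) = inj₂ (trans (cong g p) s , trans (cong g q) r)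
  EdgeTo-∘ {g = g} (inj₂ (p , q)) (inj₂ (r , s)) = inj₁ (trans (cong g p) s , trans (cong g q) r)

  EdgeTo-resp : ∀ {f g : ℕ → ℕ} {u v x y e'} → g x ≡ f u → g y ≡ f v → EdgeTo f (u , v) e' → EdgeTo g (x , y) e'
  EdgeTo-resp eu ev (inj₁ (p , q)) = inj₁ (trans eu p , trans ev q)
  EdgeTo-resp eu ev (inj₂ (p , q)) = inj₂ (trans eu p , trans ev q)

  EdgeTo-post : ∀ {f} h {u v u' v'} → EdgeTo f (u , v) (u' , v') → EdgeTo (h ∘ f) (u , v) (h u' , h v')
  EdgeTo-post h (inj₁ (p , q)) = inj₁ (cong h p , cong h q)
  EdgeTo-post h (inj₂ (p , q)) = inj₂ (cong h p , cong h q)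

  Relabels-id : ∀ {Γ} → Relabels id Γ Γ
  Relabels-id = Pointwise.refl EdgeTo-id

  Relabels-∘ : ∀ {f g Γ Γ' Γ''} → Relabels f Γ Γ' → Relabels g Γ' Γ'' → Relabels (g ∘ f) Γ Γ''
  Relabels-∘ {f} {g} = Pointwise.transitive (EdgeTo-∘ {f} {g})

  ≅-refl : ∀ {Γ} → Γ ≅ Γ
  ≅-refl = id , id , Relabels-id , Relabels-id

  ≅-trans : ∀ {Γ Γ' Γ''} → Γ ≅ Γ' → Γ' ≅ Γ'' → Γ ≅ Γ''
  ≅-trans (f , g , p , q) (f' , g' , p' , q') = f' ∘ f , g ∘ g' , Relabels-∘ p p' , Relabels-∘ q' q

  ≡⇒≅ : ∀ {Γ Γ'} → Γ ≡ Γ' → Γ ≅ Γ'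
  ≡⇒≅ refl = ≅-refl

  VerticesBelow : ℕ → TAG → Set
  VerticesBelow b = All (λ e → proj₁ e < b × proj₂ e < b)

  VerticesBelow-mono : ∀ {b b'} → b ≤ b' → ∀ {Γ} → VerticesBelow b Γ → VerticesBelow b' Γ
  VerticesBelow-mono b≤b' = All.map (λ (p , q) → ℕ.<-≤-trans p b≤b' , ℕ.<-≤-trans q b≤b')

  VerticesBelow-bound : ∀ Γ → VerticesBelow (bound Γ) Γ
  VerticesBelow-bound [] = []
  VerticesBelow-bound ((u , v) ∷ Γ) =
    (ℕ.≤-trans (ℕ.m≤m⊔n (suc u) (suc v)) (ℕ.m≤m⊔n _ (bound Γ)) ,
     ℕ.≤-trans (ℕ.m≤n⊔m (suc u) (suc v)) (ℕ.m≤m⊔n _ (bound Γ))) ∷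
    VerticesBelow-mono (ℕ.m≤n⊔m (suc u ⊔ suc v) (bound Γ)) (VerticesBelow-bound Γ)

  glue : ℕ → ℕ → (ℕ → ℕ) → (ℕ → ℕ) → ℕ → ℕ
  glue b b' f g y with y <? b
  ... | yes _ = f y
  ... | no _ = b' + g (y ∸ b)

  glue-< : ∀ b b' f g {y} → y < b → glue b b' f g y ≡ f y
  glue-< b b' f g {y} y<b with y <? b
  ... | yes _ = refl
  ... | no y≮b = ⊥-elim (y≮b y<b)

  glue-+ : ∀ b b' f g u → glue b b' f g (b + u) ≡ b' + g u
  glue-+ b b' f g u with b + u <? b
  ... | yes b+u<b = ⊥-elim (ℕ.m+n≮m b u b+u<b)
  ... | no _ = cong (λ z → b' + g z) (ℕ.m+n∸m≡n b u)

  Relabels-glueˡ : ∀ {b b' f g X X'} → VerticesBelow b X → Relabels f X X' → Relabels (glue b b' f g) X X'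
  Relabels-glueˡ [] [] = []
  Relabels-glueˡ {b} {b'} {f} {g} ((pu , pv) ∷ bs) (r ∷ rs) =
    EdgeTo-resp {f} {glue b b' f g} (glue-< b b' f g pu) (glue-< b b' f g pv) r ∷ Relabels-glueˡ bs rs

  Relabels-glueʳ : ∀ {b b' f g Y Y'} → Relabels g Y Y' → Relabels (glue b b' f g) (shift b Y) (shift b' Y')
  Relabels-glueʳ [] = []
  Relabels-glueʳ {b} {b'} {f} {g} (r ∷ rs) =
    EdgeTo-resp {(b' +_) ∘ g} {glue b b' f g} (glue-+ b b' f g _) (glue-+ b b' f g _) (EdgeTo-post {g} (b' +_) r)
    ∷ Relabels-glueʳ rs

  ++-shift-≅ : ∀ {b b' X X' Y Y'} → VerticesBelow b X → VerticesBelow b' X' → X ≅ X' → Y ≅ Y' →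
               (X ++ shift b Y) ≅ (X' ++ shift b' Y')
  ++-shift-≅ {b} {b'} bX bX' (f , f⁻¹ , p , p⁻¹) (g , g⁻¹ , q , q⁻¹) =
    glue b b' f g , glue b' b f⁻¹ g⁻¹ ,
    Pointwise.++⁺ (Relabels-glueˡ bX p) (Relabels-glueʳ q) ,
    Pointwise.++⁺ (Relabels-glueˡ bX' p⁻¹) (Relabels-glueʳ q⁻¹)

  ⊔ᵀ-cong : ∀ {X X' Y Y'} → X ≅ X' → Y ≅ Y' → (X ⊔ᵀ Y) ≅ (X' ⊔ᵀ Y')
  ⊔ᵀ-cong {X} {X'} = ++-shift-≅ (VerticesBelow-bound X) (VerticesBelow-bound X')

  shiftEdge : ℕ → Edge → Edge
  shiftEdge b (u , v) = (b + u , b + v)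

  ⊔ᵀ-assoc : ∀ X Y Z → ((X ⊔ᵀ Y) ⊔ᵀ Z) ≅ (X ⊔ᵀ (Y ⊔ᵀ Z))
  ⊔ᵀ-assoc X Y Z = ≅-trans (++-shift-≅ (VerticesBelow-bound _) X⊔ᵀY-below ≅-refl ≅-refl) (≡⇒≅ (sym eq))
    where
    bX = bound X
    bY = bound Y
    X⊔ᵀY-below : VerticesBelow (bX + bY) (X ++ shift bX Y)
    X⊔ᵀY-below = All.++⁺ (VerticesBelow-mono (ℕ.m≤m+n bX bY) (VerticesBelow-bound X))
                         (All.map⁺ (All.map (λ (pu , pv) → ℕ.+-monoʳ-< bX pu , ℕ.+-monoʳ-< bX pv) (VerticesBelow-bound Y)))
    shift-shift : ∀ e → shiftEdge bX (shiftEdge bY e) ≡ shiftEdge (bX + bY) e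
    shift-shift (u , v) = cong₂ _,_ (sym (ℕ.+-assoc bX bY u)) (sym (ℕ.+-assoc bX bY v))
    open ≡.≡-Reasoning
    eq : X ⊔ᵀ (Y ⊔ᵀ Z) ≡ (X ++ shift bX Y) ++ shift (bX + bY) Z
    eq = begin
      X ++ shift bX (Y ++ shift bY Z)                ≡⟨ cong (X ++_) (List.map-++ (shiftEdge bX) Y (shift bY Z)) ⟩
      X ++ (shift bX Y ++ shift bX (shift bY Z))     ≡⟨ List.++-assoc X (shift bX Y) _ ⟨
      (X ++ shift bX Y) ++ shift bX (shift bY Z)     ≡⟨ cong ((X ++ shift bX Y) ++_) (map-map shift-shift Z) ⟩
      (X ++ shift bX Y) ++ shift (bX + bY) Z         ∎

  ⊔ᵀ-identityˡ : ∀ Γ → ([] ⊔ᵀ Γ) ≡ Γ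
  ⊔ᵀ-identityˡ [] = refl
  ⊔ᵀ-identityˡ (e ∷ Γ) = cong (e ∷_) (⊔ᵀ-identityˡ Γ)

  ≡ᵇ⇒≡ : ∀ {m n} → (m ≡ᵇ n) ≡ true → m ≡ n
  ≡ᵇ⇒≡ {m} {n} eq = ℕ.≡ᵇ⇒≡ m n (Equivalence.from T-≡ eq)

  ≡ᵇ-refl : ∀ m → (m ≡ᵇ m) ≡ true
  ≡ᵇ-refl m = Equivalence.to T-≡ (ℕ.≡⇒≡ᵇ m m refl)

  -- A copy of the step function local to rep, so that rep γ unfolds to foldl mergeStep id γ.
  mergeStep : (ℕ → ℕ) → Edge → ℕ → ℕ
  mergeStep r (u , v) x = if r x ≡ᵇ r v then r u else r x

  data Connected (γ : TAG) : ℕ → ℕ → Set where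
    c-refl  : ∀ {x} → Connected γ x x
    c-sym   : ∀ {x y} → Connected γ x y → Connected γ y x
    c-trans : ∀ {x y z} → Connected γ x y → Connected γ y z → Connected γ x z
    c-edge  : ∀ {u v} → (u , v) ∈ γ → Connected γ u v

  Connected-mono : ∀ {γ δ} → (∀ {e} → e ∈ γ → e ∈ δ) → ∀ {x y} → Connected γ x y → Connected δ x y
  Connected-mono γ⊆δ c-refl = c-refl
  Connected-mono γ⊆δ (c-sym c) = c-sym (Connected-mono γ⊆δ c)
  Connected-mono γ⊆δ (c-trans c d) = c-trans (Connected-mono γ⊆δ c) (Connected-mono γ⊆δ d)
  Connected-mono γ⊆δ (c-edge e∈γ) = c-edge (γ⊆δ e∈γ)

  ≡⇒Connected : ∀ {γ x y} → x ≡ y → Connected γ x y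
  ≡⇒Connected refl = c-refl

  foldl-mergeStep-connected : ∀ δ r γ → (∀ x → Connected δ (r x) x) →
                              ∀ x → Connected (δ ++ γ) (foldl mergeStep r γ x) x
  foldl-mergeStep-connected δ r [] r-conn x =
    subst (λ δ' → Connected δ' (r x) x) (sym (List.++-identityʳ δ)) (r-conn x)
  foldl-mergeStep-connected δ r ((u , v) ∷ γ) r-conn x =
    subst (λ δ' → Connected δ' (foldl mergeStep r ((u , v) ∷ γ) x) x) (List.++-assoc δ [ (u , v) ] γ)
      (foldl-mergeStep-connected (δ ++ [ (u , v) ]) (mergeStep r (u , v)) γ step-conn x)
    where
    weaken : ∀ {a b} → Connected δ a b → Connected (δ ++ [ (u , v) ]) a b
    weaken = Connected-mono ∈-++⁺ˡ
    step-conn : ∀ x → Connected (δ ++ [ (u , v) ]) (mergeStep r (u , v) x) x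
    step-conn x with r x ≡ᵇ r v in eq
    ... | true = c-trans (weaken (r-conn u)) (c-trans (c-edge (∈-++⁺ʳ δ (here refl)))
                   (c-trans (c-sym (weaken (r-conn v))) (c-trans (≡⇒Connected (sym (≡ᵇ⇒≡ eq))) (weaken (r-conn x)))))
    ... | false = weaken (r-conn x)

  rep-connected : ∀ γ x → Connected γ (rep γ x) x
  rep-connected γ = foldl-mergeStep-connected [] id γ (λ _ → c-refl)

  foldl-mergeStep-resp : ∀ r γ {x y} → r x ≡ r y → foldl mergeStep r γ x ≡ foldl mergeStep r γ y
  foldl-mergeStep-resp r [] rx≡ry = rx≡ry
  foldl-mergeStep-resp r ((u , v) ∷ γ) rx≡ry =
    foldl-mergeStep-resp (mergeStep r (u , v)) γ (cong (λ z → if z ≡ᵇ r v then r u else z) rx≡ry)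

  foldl-mergeStep-edge : ∀ r γ {u v} → (u , v) ∈ γ → foldl mergeStep r γ u ≡ foldl mergeStep r γ v
  foldl-mergeStep-edge r ((u , v) ∷ γ) (here refl) =
    foldl-mergeStep-resp (mergeStep r (u , v)) γ (trans step-u (sym step-v))
    where
    step-u : mergeStep r (u , v) u ≡ r u
    step-u with r u ≡ᵇ r v
    ... | true = refl
    ... | false = refl
    step-v : mergeStep r (u , v) v ≡ r u
    step-v rewrite ≡ᵇ-refl (r v) = refl
  foldl-mergeStep-edge r (e ∷ γ) (there e∈γ) = foldl-mergeStep-edge (mergeStep r e) γ e∈γ

  Connected-elim : ∀ {γ} (h : ℕ → ℕ) → (∀ {u v} → (u , v) ∈ γ → h u ≡ h v) →
                   ∀ {x y} → Connected γ x y → h x ≡ h y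
  Connected-elim h h-edge c-refl = refl
  Connected-elim h h-edge (c-sym c) = sym (Connected-elim h h-edge c)
  Connected-elim h h-edge (c-trans c d) = trans (Connected-elim h h-edge c) (Connected-elim h h-edge d)
  Connected-elim h h-edge (c-edge e∈γ) = h-edge e∈γ

  rep-resp : ∀ γ {x y} → Connected γ x y → rep γ x ≡ rep γ y
  rep-resp γ = Connected-elim (rep γ) (foldl-mergeStep-edge id γ)

  Connected-relabel : ∀ {f γ γ'} → Relabels f γ γ' → ∀ {x y} → Connected γ x y → Connected γ' (f x) (f y)
  Connected-relabel p c-refl = c-refl
  Connected-relabel p (c-sym c) = c-sym (Connected-relabel p c)
  Connected-relabel p (c-trans c d) = c-trans (Connected-relabel p c) (Connected-relabel p d)
  Connected-relabel p (c-edge e∈γ) with Pointwise-∈ p e∈γ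
  ... | _ , e'∈γ' , inj₁ (fu≡ , fv≡) = subst₂ (Connected _) (sym fu≡) (sym fv≡) (c-edge e'∈γ')
  ... | _ , e'∈γ' , inj₂ (fu≡ , fv≡) = c-sym (subst₂ (Connected _) (sym fv≡) (sym fu≡) (c-edge e'∈γ'))

  selections-pointwise : ∀ {P : Edge → Edge → Set} {Γ Γ'} → Pointwise P Γ Γ' →
    Pointwise (×-Pointwise (Pointwise P) (Pointwise P)) (selections Γ) (selections Γ')
  selections-pointwise [] = ([] , []) ∷ []
  selections-pointwise (p ∷ ps) =
    Pointwise.++⁺ (Pointwise.map⁺ _ _ (Pointwise.map (λ (qs , rs) → p ∷ qs , rs) (selections-pointwise ps)))
                  (Pointwise.map⁺ _ _ (Pointwise.map (λ (qs , rs) → qs , p ∷ rs) (selections-pointwise ps)))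

  contract-relabel : ∀ {f s s' r r'} → Relabels f s s' → Relabels f r r' →
                     Relabels (rep s' ∘ f) (contract s r) (contract s' r')
  contract-relabel ps [] = []
  contract-relabel {f} {s} {s'} ps (p ∷ rs) =
    EdgeTo-resp {rep s' ∘ f} {rep s' ∘ f} (rep-resp-f _) (rep-resp-f _) (EdgeTo-post {f} (rep s') p) ∷ contract-relabel ps rs
    where
    rep-resp-f : ∀ x → rep s' (f (rep s x)) ≡ rep s' (f x)
    rep-resp-f x = rep-resp s' (Connected-relabel ps (rep-connected s x))

  coproductTerm : TAG × TAG → TAG × TAG
  coproductTerm (γ , rest) = γ , contract γ rest

  SelectionIso : TAG × TAG → TAG × TAG → Set
  SelectionIso σ σ' = ×-Pointwise _≅_ _≅_ (coproductTerm σ) (coproductTerm σ')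

  selections-≅ : ∀ {Γ Γ'} → Γ ≅ Γ' → Pointwise SelectionIso (selections Γ) (selections Γ')
  selections-≅ (f , g , p , q) =
    Pointwise.map iso (selections-pointwise (Pointwise-zip p (Pointwise.symmetric id q)))
    where
    iso : ∀ {σ σ'} → ×-Pointwise (Pointwise _) (Pointwise _) σ σ' → SelectionIso σ σ'
    iso (ps , rs) =
      let fs = Pointwise.map proj₁ ps ; gs = Pointwise.symmetric proj₂ ps in
      (f , g , fs , gs) ,
      (_ , _ , contract-relabel fs (Pointwise.map proj₁ rs) , contract-relabel gs (Pointwise.symmetric proj₂ rs))

  -- Iterated shrinking: C/(A ∪ B) ≅ (C/A)/((A ∪ B)/A)

  contract-contract-≅ : ∀ A B AB C → (∀ {e} → e ∈ A → e ∈ AB) → (∀ {e} → e ∈ B → e ∈ AB) →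
                        (∀ {e} → e ∈ AB → e ∈ A ⊎ e ∈ B) →
                        contract AB C ≅ contract (contract A B) (contract A C)
  contract-contract-≅ A B AB C A⊆AB B⊆AB AB⊆A∪B = F , rep AB , forth C , back C
    where
    B/A = contract A B
    F : ℕ → ℕ
    F y = rep B/A (rep A y)
    F-edge : ∀ {u v} → (u , v) ∈ AB → F u ≡ F v
    F-edge e∈AB with AB⊆A∪B e∈AB
    ... | inj₁ e∈A = cong (rep B/A) (rep-resp A (c-edge e∈A))
    ... | inj₂ e∈B = rep-resp B/A (c-edge (∈-map⁺ _ e∈B))
    rep-AB-rep-A : ∀ x → rep AB (rep A x) ≡ rep AB x
    rep-AB-rep-A x = rep-resp AB (Connected-mono A⊆AB (rep-connected A x))
    rep-AB-edge : ∀ {p q} → (p , q) ∈ B/A → rep AB p ≡ rep AB q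
    rep-AB-edge e∈B/A with ∈-map⁻ _ e∈B/A
    ... | (x , y) , e∈B , refl =
      trans (rep-AB-rep-A x) (trans (rep-resp AB (c-edge (B⊆AB e∈B))) (sym (rep-AB-rep-A y)))
    F-rep-AB : ∀ x → F (rep AB x) ≡ F x
    F-rep-AB x = Connected-elim F F-edge (rep-connected AB x)
    rep-AB-F : ∀ x → rep AB (F x) ≡ rep AB x
    rep-AB-F x = trans (Connected-elim (rep AB) rep-AB-edge (rep-connected B/A (rep A x))) (rep-AB-rep-A x)
    forth : ∀ C → Relabels F (contract AB C) (contract B/A (contract A C))
    forth [] = []
    forth ((u , v) ∷ C) = inj₁ (F-rep-AB u , F-rep-AB v) ∷ forth C
    back : ∀ C → Relabels (rep AB) (contract B/A (contract A C)) (contract AB C)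
    back [] = []
    back ((u , v) ∷ C) = inj₁ (rep-AB-F u , rep-AB-F v) ∷ back C

  MapsBelow : ℕ → (ℕ → ℕ) → Set
  MapsBelow b r = ∀ {x} → x < b → r x < b

  Shifts : ℕ → (ℕ → ℕ) → (ℕ → ℕ) → Set
  Shifts b r r' = ∀ y → r (b + y) ≡ b + r' y

  +-≡ᵇ : ∀ b p q → (b + p ≡ᵇ b + q) ≡ (p ≡ᵇ q)
  +-≡ᵇ zero p q = refl
  +-≡ᵇ (suc b) p q = +-≡ᵇ b p q

  mergeStep-below : ∀ {b r u v} → MapsBelow b r → u < b → v < b → MapsBelow b (mergeStep r (u , v))
  mergeStep-below {r = r} {v = v} r-below u<b v<b {x} x<b with r x ≡ᵇ r v
  ... | true = r-below u<b
  ... | false = r-below x<b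

  foldl-mergeStep-below : ∀ {b r} s → VerticesBelow b s → MapsBelow b r → MapsBelow b (foldl mergeStep r s)
  foldl-mergeStep-below [] [] r-below = r-below
  foldl-mergeStep-below (_ ∷ s) ((u<b , v<b) ∷ s-below) r-below =
    foldl-mergeStep-below s s-below (mergeStep-below r-below u<b v<b)

  rep-below : ∀ {b} s → VerticesBelow b s → MapsBelow b (rep s)
  rep-below s s-below = foldl-mergeStep-below s s-below id

  foldl-mergeStep-fixes : ∀ {b r x} s → VerticesBelow b s → MapsBelow b r → b ≤ x → r x ≡ x →
                          foldl mergeStep r s x ≡ x
  foldl-mergeStep-fixes [] [] r-below b≤x rx≡x = rx≡x
  foldl-mergeStep-fixes {b} {r} {x} ((u , v) ∷ s) ((u<b , v<b) ∷ s-below) r-below b≤x rx≡x =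
    foldl-mergeStep-fixes s s-below (mergeStep-below r-below u<b v<b) b≤x step-fixes
    where
    step-fixes : mergeStep r (u , v) x ≡ x
    step-fixes with r x ≡ᵇ r v in eq
    ... | true = ⊥-elim (ℕ.<⇒≱ (r-below v<b) (subst (b ≤_) (trans (sym rx≡x) (≡ᵇ⇒≡ eq)) b≤x))
    ... | false = rx≡x

  mergeStep-shift-< : ∀ {b r r' u v x} → MapsBelow b r → Shifts b r r' → x < b →
                      mergeStep r (b + u , b + v) x ≡ r x
  mergeStep-shift-< {b} {r} {r'} {v = v} {x} r-below r-shifts x<b with r x ≡ᵇ r (b + v) in eq
  ... | true = ⊥-elim (ℕ.<⇒≱ (r-below x<b) (subst (b ≤_) (sym (trans (≡ᵇ⇒≡ eq) (r-shifts v))) (ℕ.m≤m+n b (r' v))))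
  ... | false = refl

  mergeStep-shift-+ : ∀ {b r r' u v} → Shifts b r r' → Shifts b (mergeStep r (b + u , b + v)) (mergeStep r' (u , v))
  mergeStep-shift-+ {b} {r} {r'} {u} {v} r-shifts y
    rewrite r-shifts y | r-shifts v | r-shifts u | +-≡ᵇ b (r' y) (r' v) with r' y ≡ᵇ r' v
  ... | true = refl
  ... | false = refl

  foldl-mergeStep-shift-+ : ∀ {b r r'} t → Shifts b r r' →
                            Shifts b (foldl mergeStep r (shift b t)) (foldl mergeStep r' t)
  foldl-mergeStep-shift-+ [] r-shifts = r-shifts
  foldl-mergeStep-shift-+ {b} {r} {r'} ((u , v) ∷ t) r-shifts =
    foldl-mergeStep-shift-+ t (mergeStep-shift-+ {b} {r} {r'} {u} {v} r-shifts)

  foldl-mergeStep-shift-< : ∀ {b r r' x} t → MapsBelow b r → Shifts b r r' → x < b →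
                            foldl mergeStep r (shift b t) x ≡ r x
  foldl-mergeStep-shift-< [] r-below r-shifts x<b = refl
  foldl-mergeStep-shift-< {b} {r} {r'} ((u , v) ∷ t) r-below r-shifts x<b =
    trans (foldl-mergeStep-shift-< t r₁-below (mergeStep-shift-+ {b} {r} {r'} {u} {v} r-shifts) x<b)
          (mergeStep-shift-< {b} {r} {r'} {u} {v} r-below r-shifts x<b)
    where
    r₁-below : MapsBelow b (mergeStep r (b + u , b + v))
    r₁-below x<b = subst (_< b) (sym (mergeStep-shift-< {b} {r} {r'} {u} {v} r-below r-shifts x<b)) (r-below x<b)

  module _ {b : ℕ} (s₁ s₂ : TAG) (s₁-below : VerticesBelow b s₁) where

    private
      rep-s₁-shifts : Shifts b (rep s₁) id
      rep-s₁-shifts y = foldl-mergeStep-fixes s₁ s₁-below id (ℕ.m≤m+n b y) refl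

      rep-++ : ∀ x → rep (s₁ ++ shift b s₂) x ≡ foldl mergeStep (rep s₁) (shift b s₂) x
      rep-++ x = cong (λ r → r x) (List.foldl-++ mergeStep id s₁ (shift b s₂))

    rep-++-shift-< : ∀ {x} → x < b → rep (s₁ ++ shift b s₂) x ≡ rep s₁ x
    rep-++-shift-< x<b = trans (rep-++ _) (foldl-mergeStep-shift-< s₂ (rep-below s₁ s₁-below) rep-s₁-shifts x<b)

    rep-++-shift-+ : Shifts b (rep (s₁ ++ shift b s₂)) (rep s₂)
    rep-++-shift-+ y = trans (rep-++ (b + y)) (foldl-mergeStep-shift-+ s₂ rep-s₁-shifts y)

    contract-++-shift : ∀ r₁ r₂ → VerticesBelow b r₁ →
      contract (s₁ ++ shift b s₂) (r₁ ++ shift b r₂) ≡ contract s₁ r₁ ++ shift b (contract s₂ r₂)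
    contract-++-shift r₁ r₂ r₁-below =
      trans (List.map-++ _ r₁ (shift b r₂)) (cong₂ _++_ contract-r₁ contract-r₂)
      where
      contract-r₁ : contract (s₁ ++ shift b s₂) r₁ ≡ contract s₁ r₁
      contract-r₁ = List.map-cong-local (All.map (λ (u<b , v<b) → cong₂ _,_ (rep-++-shift-< u<b) (rep-++-shift-< v<b)) r₁-below)
      contract-r₂ : contract (s₁ ++ shift b s₂) (shift b r₂) ≡ shift b (contract s₂ r₂)
      contract-r₂ = trans (sym (List.map-∘ r₂))
                     (trans (List.map-cong (λ (u , v) → cong₂ _,_ (rep-++-shift-+ u) (rep-++-shift-+ v)) r₂) (List.map-∘ r₂))

    coproductTerm-⊔ᵀ : ∀ r₁ r₂ → VerticesBelow b r₁ →
      ×-Pointwise _≅_ _≅_ (coproductTerm (s₁ ++ shift b s₂ , r₁ ++ shift b r₂))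
                          (zip′ _⊔ᵀ_ _⊔ᵀ_ (coproductTerm (s₁ , r₁)) (coproductTerm (s₂ , r₂)))
    coproductTerm-⊔ᵀ r₁ r₂ r₁-below =
      ++-shift-≅ s₁-below (VerticesBelow-bound s₁) ≅-refl ≅-refl ,
      ≅-trans (≡⇒≅ (contract-++-shift r₁ r₂ r₁-below))
        (++-shift-≅ (All.map⁺ (All.map (λ (u<b , v<b) → rep-below s₁ s₁-below u<b , rep-below s₁ s₁-below v<b) r₁-below))
                    (VerticesBelow-bound _) ≅-refl ≅-refl)

  selections-map : ∀ (φ : Edge → Edge) Γ → selections (map φ Γ) ≡ map (Product.map (map φ) (map φ)) (selections Γ)
  selections-map φ [] = refl
  selections-map φ (e ∷ Γ) rewrite selections-map φ Γ =
    sym (map-++-natural (λ _ → refl) (λ _ → refl) (selections Γ))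

  selections-++ : ∀ Γ₁ Γ₂ →
    selections (Γ₁ ++ Γ₂) ≡ cartesianProductWith (zip′ _++_ _++_) (selections Γ₁) (selections Γ₂)
  selections-++ [] Γ₂ = sym (trans (List.++-identityʳ _) (trans (List.map-cong (λ _ → refl) (selections Γ₂)) (List.map-id _)))
  selections-++ (e ∷ Γ₁) Γ₂ rewrite selections-++ Γ₁ Γ₂ =
    trans (cong₂ _++_ (trans (map-cartesianProductWith _ _ (selections Γ₁) (selections Γ₂))
                             (sym (cartesianProductWith-mapˡ _ _ (selections Γ₁) (selections Γ₂))))
                      (trans (map-cartesianProductWith _ _ (selections Γ₁) (selections Γ₂))
                             (sym (cartesianProductWith-mapˡ _ _ (selections Γ₁) (selections Γ₂)))))
          (sym (List.cartesianProductWith-distribʳ-++ _ (map _ (selections Γ₁)) _ (selections Γ₂)))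

  selections-All : ∀ {P : Edge → Set} {Γ} → All P Γ → All (λ (s , r) → All P s × All P r) (selections Γ)
  selections-All [] = ([] , []) ∷ []
  selections-All (p ∷ ps) =
    All.++⁺ (All.map⁺ (All.map (λ (qs , rs) → p ∷ qs , rs) (selections-All ps)))
            (All.map⁺ (All.map (λ (qs , rs) → qs , p ∷ rs) (selections-All ps)))

  selections-first : ∀ Γ → ∃ λ σs → selections Γ ≡ (Γ , []) ∷ σs × All (λ σ → null (proj₂ σ) ≡ false) σs
  selections-first [] = [] , refl , []
  selections-first (e ∷ Γ) with selections-first Γ
  ... | σs , eq , σs-nonempty rewrite eq =
    map _ σs ++ map _ ((Γ , []) ∷ σs) , refl ,
    All.++⁺ (All.map⁺ σs-nonempty) (All.map⁺ (All.universal (λ _ → refl) _))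

  selections-last : ∀ Γ → ∃ λ σs → selections Γ ≡ σs ++ [ ([] , Γ) ] × All (λ σ → null (proj₁ σ) ≡ false) σs
  selections-last [] = [] , refl , []
  selections-last (e ∷ Γ) with selections-last Γ
  ... | σs , eq , σs-nonempty rewrite eq =
    map _ (σs ++ [ ([] , Γ) ]) ++ map _ σs ,
    trans (cong (map _ (σs ++ [ ([] , Γ) ]) ++_) (List.map-++ _ σs [ ([] , Γ) ]))
          (sym (List.++-assoc (map _ (σs ++ [ ([] , Γ) ])) (map _ σs) _)) ,
    All.++⁺ (All.map⁺ (All.universal (λ _ → refl) _)) (All.map⁺ σs-nonempty)

  contract-[] : ∀ Γ → contract [] Γ ≡ Γ
  contract-[] [] = refl
  contract-[] (e ∷ Γ) = cong (e ∷_) (contract-[] Γ)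

  -- Two-step selections as three-part labellings

  Choice : Set
  Choice = List (Bool × Edge)

  chosen unchosen : Choice → TAG
  chosen [] = []
  chosen ((true , e) ∷ l) = e ∷ chosen l
  chosen ((false , e) ∷ l) = chosen l
  unchosen [] = []
  unchosen ((true , e) ∷ l) = unchosen l
  unchosen ((false , e) ∷ l) = e ∷ unchosen l

  choices : TAG → List Choice
  choices [] = [ [] ]
  choices (e ∷ Γ) = map ((true , e) ∷_) (choices Γ) ++ map ((false , e) ∷_) (choices Γ)

  selections-choices : ∀ Γ → selections Γ ≡ map (λ l → chosen l , unchosen l) (choices Γ)
  selections-choices [] = refl
  selections-choices (e ∷ Γ) rewrite selections-choices Γ =
    sym (map-++-natural (λ _ → refl) (λ _ → refl) (choices Γ))

  data Part : Set where
    left middle right : Part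

  Labelling : Set
  Labelling = List (Part × Edge)

  leftEdges middleEdges rightEdges leftMiddleEdges : Labelling → TAG
  leftEdges [] = []
  leftEdges ((left , e) ∷ m) = e ∷ leftEdges m
  leftEdges ((middle , e) ∷ m) = leftEdges m
  leftEdges ((right , e) ∷ m) = leftEdges m
  middleEdges [] = []
  middleEdges ((left , e) ∷ m) = middleEdges m
  middleEdges ((middle , e) ∷ m) = e ∷ middleEdges m
  middleEdges ((right , e) ∷ m) = middleEdges m
  rightEdges [] = []
  rightEdges ((left , e) ∷ m) = rightEdges m
  rightEdges ((middle , e) ∷ m) = rightEdges m
  rightEdges ((right , e) ∷ m) = e ∷ rightEdges m
  leftMiddleEdges [] = []
  leftMiddleEdges ((left , e) ∷ m) = e ∷ leftMiddleEdges m
  leftMiddleEdges ((middle , e) ∷ m) = e ∷ leftMiddleEdges m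
  leftMiddleEdges ((right , e) ∷ m) = leftMiddleEdges m

  labellings : TAG → List Labelling
  labellings [] = [ [] ]
  labellings (e ∷ Γ) =
    map ((left , e) ∷_) (labellings Γ) ++ (map ((middle , e) ∷_) (labellings Γ) ++ map ((right , e) ∷_) (labellings Γ))

  refineChosen refineUnchosen : Choice → List Labelling
  refineChosen [] = [ [] ]
  refineChosen ((true , e) ∷ l) = map ((left , e) ∷_) (refineChosen l) ++ map ((middle , e) ∷_) (refineChosen l)
  refineChosen ((false , e) ∷ l) = map ((right , e) ∷_) (refineChosen l)
  refineUnchosen [] = [ [] ]
  refineUnchosen ((true , e) ∷ l) = map ((left , e) ∷_) (refineUnchosen l)
  refineUnchosen ((false , e) ∷ l) = map ((middle , e) ∷_) (refineUnchosen l) ++ map ((right , e) ∷_) (refineUnchosen l)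

  selections-chosen : ∀ l → selections (chosen l) ≡ map (λ m → leftEdges m , middleEdges m) (refineChosen l)
  selections-chosen [] = refl
  selections-chosen ((true , e) ∷ l) rewrite selections-chosen l =
    sym (map-++-natural (λ _ → refl) (λ _ → refl) (refineChosen l))
  selections-chosen ((false , e) ∷ l) rewrite selections-chosen l = sym (map-map (λ _ → refl) (refineChosen l))

  selections-unchosen : ∀ l → selections (unchosen l) ≡ map (λ m → middleEdges m , rightEdges m) (refineUnchosen l)
  selections-unchosen [] = refl
  selections-unchosen ((true , e) ∷ l) rewrite selections-unchosen l = sym (map-map (λ _ → refl) (refineUnchosen l))
  selections-unchosen ((false , e) ∷ l) rewrite selections-unchosen l =
    sym (map-++-natural (λ _ → refl) (λ _ → refl) (refineUnchosen l))

  refineChosen-parts : ∀ l → All (λ m → leftMiddleEdges m ≡ chosen l × rightEdges m ≡ unchosen l) (refineChosen l)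
  refineChosen-parts [] = (refl , refl) ∷ []
  refineChosen-parts ((true , e) ∷ l) =
    All.++⁺ (All.map⁺ (All.map (Product.map₁ (cong (e ∷_))) (refineChosen-parts l)))
            (All.map⁺ (All.map (Product.map₁ (cong (e ∷_))) (refineChosen-parts l)))
  refineChosen-parts ((false , e) ∷ l) = All.map⁺ (All.map (Product.map₂ (cong (e ∷_))) (refineChosen-parts l))

  refineUnchosen-parts : ∀ l → All (λ m → leftEdges m ≡ chosen l) (refineUnchosen l)
  refineUnchosen-parts [] = refl ∷ []
  refineUnchosen-parts ((true , e) ∷ l) = All.map⁺ (All.map (cong (e ∷_)) (refineUnchosen-parts l))
  refineUnchosen-parts ((false , e) ∷ l) = All.++⁺ (All.map⁺ (refineUnchosen-parts l)) (All.map⁺ (refineUnchosen-parts l))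

  module _ (e : Edge) (Γ : TAG) where
    private
      L = choices Γ
      tag : Part → Labelling → Labelling
      tag p = (p , e) ∷_
      tagged : Part → (Choice → List Labelling) → List Labelling
      tagged p f = concatMap (map (tag p) ∘ f) L
      tagged-≡ : ∀ p f → tagged p f ≡ map (tag p) (concatMap f L)
      tagged-≡ p f = sym (List.map-concatMap (tag p) f L)
      concatMap-choices : ∀ (f : Choice → List Labelling) → concatMap f (choices (e ∷ Γ)) ≡
                                concatMap (f ∘ ((true , e) ∷_)) L ++ concatMap (f ∘ ((false , e) ∷_)) L
      concatMap-choices f = trans (List.concatMap-++ f (map _ L) (map _ L))
                                  (cong₂ _++_ (List.concatMap-map f _ L) (List.concatMap-map f _ L))
      open ↭.PermutationReasoning

    refineChosen-∷-↭ : concatMap refineChosen L ↭ labellings Γ →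
                       concatMap refineChosen (choices (e ∷ Γ)) ↭ labellings (e ∷ Γ)
    refineChosen-∷-↭ IH = begin
      concatMap refineChosen (choices (e ∷ Γ))
        ≡⟨ concatMap-choices refineChosen ⟩
      concatMap (λ l → map (tag left) (refineChosen l) ++ map (tag middle) (refineChosen l)) L ++ tagged right refineChosen
        ↭⟨ ↭.++⁺ʳ _ (concatMap-++-↭ _ _ L) ⟩
      (tagged left refineChosen ++ tagged middle refineChosen) ++ tagged right refineChosen
        ≡⟨ cong₂ _++_ (cong₂ _++_ (tagged-≡ left _) (tagged-≡ middle _)) (tagged-≡ right _) ⟩
      (map (tag left) X ++ map (tag middle) X) ++ map (tag right) X
        ≡⟨ List.++-assoc (map (tag left) X) _ _ ⟩
      map (tag left) X ++ (map (tag middle) X ++ map (tag right) X)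
        ↭⟨ ↭.++⁺ (↭.map⁺ _ IH) (↭.++⁺ (↭.map⁺ _ IH) (↭.map⁺ _ IH)) ⟩
      labellings (e ∷ Γ) ∎
      where X = concatMap refineChosen L

    refineUnchosen-∷-↭ : concatMap refineUnchosen L ↭ labellings Γ →
                         concatMap refineUnchosen (choices (e ∷ Γ)) ↭ labellings (e ∷ Γ)
    refineUnchosen-∷-↭ IH = begin
      concatMap refineUnchosen (choices (e ∷ Γ))
        ≡⟨ concatMap-choices refineUnchosen ⟩
      tagged left refineUnchosen ++ concatMap (λ l → map (tag middle) (refineUnchosen l) ++ map (tag right) (refineUnchosen l)) L
        ↭⟨ ↭.++⁺ˡ _ (concatMap-++-↭ _ _ L) ⟩
      tagged left refineUnchosen ++ (tagged middle refineUnchosen ++ tagged right refineUnchosen)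
        ≡⟨ cong₂ _++_ (tagged-≡ left _) (cong₂ _++_ (tagged-≡ middle _) (tagged-≡ right _)) ⟩
      map (tag left) X ++ (map (tag middle) X ++ map (tag right) X)
        ↭⟨ ↭.++⁺ (↭.map⁺ _ IH) (↭.++⁺ (↭.map⁺ _ IH) (↭.map⁺ _ IH)) ⟩
      labellings (e ∷ Γ) ∎
      where X = concatMap refineUnchosen L

  refineChosen-↭ : ∀ Γ → concatMap refineChosen (choices Γ) ↭ labellings Γ
  refineChosen-↭ [] = ↭.refl
  refineChosen-↭ (e ∷ Γ) = refineChosen-∷-↭ e Γ (refineChosen-↭ Γ)

  refineUnchosen-↭ : ∀ Γ → concatMap refineUnchosen (choices Γ) ↭ labellings Γ
  refineUnchosen-↭ [] = ↭.refl
  refineUnchosen-↭ (e ∷ Γ) = refineUnchosen-∷-↭ e Γ (refineUnchosen-↭ Γ)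

  left⊆leftMiddle : ∀ m {e} → e ∈ leftEdges m → e ∈ leftMiddleEdges m
  left⊆leftMiddle ((left , _) ∷ m) (here p) = here p
  left⊆leftMiddle ((left , _) ∷ m) (there e∈) = there (left⊆leftMiddle m e∈)
  left⊆leftMiddle ((middle , _) ∷ m) e∈ = there (left⊆leftMiddle m e∈)
  left⊆leftMiddle ((right , _) ∷ m) e∈ = left⊆leftMiddle m e∈

  middle⊆leftMiddle : ∀ m {e} → e ∈ middleEdges m → e ∈ leftMiddleEdges m
  middle⊆leftMiddle ((left , _) ∷ m) e∈ = there (middle⊆leftMiddle m e∈)
  middle⊆leftMiddle ((middle , _) ∷ m) (here p) = here p
  middle⊆leftMiddle ((middle , _) ∷ m) (there e∈) = there (middle⊆leftMiddle m e∈)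
  middle⊆leftMiddle ((right , _) ∷ m) e∈ = middle⊆leftMiddle m e∈

  leftMiddle⊆left∪middle : ∀ m {e} → e ∈ leftMiddleEdges m → e ∈ leftEdges m ⊎ e ∈ middleEdges m
  leftMiddle⊆left∪middle ((left , _) ∷ m) (here p) = inj₁ (here p)
  leftMiddle⊆left∪middle ((left , _) ∷ m) (there e∈) = Sum.map₁ there (leftMiddle⊆left∪middle m e∈)
  leftMiddle⊆left∪middle ((middle , _) ∷ m) (here p) = inj₂ (here p)
  leftMiddle⊆left∪middle ((middle , _) ∷ m) (there e∈) = Sum.map₂ there (leftMiddle⊆left∪middle m e∈)
  leftMiddle⊆left∪middle ((right , _) ∷ m) e∈ = leftMiddle⊆left∪middle m e∈

  TripleTAG : Set
  TripleTAG = TAG × (TAG × TAG)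

  termsΔ⊗id termsid⊗Δ : TAG → List TripleTAG
  termsΔ⊗id Γ = concatMap (λ (γ , rest) → map (λ (a , b) → a , contract a b , contract γ rest) (selections γ)) (selections Γ)
  termsid⊗Δ Γ = concatMap (λ (γ , rest) → map (λ (a , b) → γ , a , contract a b) (selections (contract γ rest))) (selections Γ)

  termΔ⊗id termid⊗Δ : Labelling → TripleTAG
  termΔ⊗id m = leftEdges m , contract (leftEdges m) (middleEdges m) , contract (leftMiddleEdges m) (rightEdges m)
  termid⊗Δ m = leftEdges m , contract (leftEdges m) (middleEdges m) ,
               contract (contract (leftEdges m) (middleEdges m)) (contract (leftEdges m) (rightEdges m))

  termΔ⊗id-≅-termid⊗Δ : ∀ m → contract (leftMiddleEdges m) (rightEdges m) ≅
                              contract (contract (leftEdges m) (middleEdges m)) (contract (leftEdges m) (rightEdges m))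
  termΔ⊗id-≅-termid⊗Δ m = contract-contract-≅ (leftEdges m) (middleEdges m) (leftMiddleEdges m) (rightEdges m)
    (left⊆leftMiddle m) (middle⊆leftMiddle m) (leftMiddle⊆left∪middle m)

  termsΔ⊗id-labellings : ∀ Γ → termsΔ⊗id Γ ≡ map termΔ⊗id (concatMap refineChosen (choices Γ))
  termsΔ⊗id-labellings Γ rewrite selections-choices Γ =
    trans (List.concatMap-map _ _ (choices Γ))
          (trans (List.concatMap-cong terms-choice (choices Γ)) (sym (List.map-concatMap termΔ⊗id refineChosen (choices Γ))))
    where
    terms-choice : ∀ l → map (λ (a , b) → a , contract a b , contract (chosen l) (unchosen l)) (selections (chosen l)) ≡
                         map termΔ⊗id (refineChosen l)
    terms-choice l rewrite selections-chosen l = trans (sym (List.map-∘ (refineChosen l)))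
      (List.map-cong-local (All.map (λ {m} (lm≡ , r≡) → cong₂ (termΔ⊗id-with m) (sym lm≡) (sym r≡)) (refineChosen-parts l)))
      where
      termΔ⊗id-with : Labelling → TAG → TAG → TripleTAG
      termΔ⊗id-with m γ rest = leftEdges m , contract (leftEdges m) (middleEdges m) , contract γ rest

  termsid⊗Δ-labellings : ∀ Γ → termsid⊗Δ Γ ≡ map termid⊗Δ (concatMap refineUnchosen (choices Γ))
  termsid⊗Δ-labellings Γ rewrite selections-choices Γ =
    trans (List.concatMap-map _ _ (choices Γ))
          (trans (List.concatMap-cong terms-choice (choices Γ)) (sym (List.map-concatMap termid⊗Δ refineUnchosen (choices Γ))))
    where
    terms-choice : ∀ l → map (λ (a , b) → chosen l , a , contract a b) (selections (contract (chosen l) (unchosen l))) ≡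
                         map termid⊗Δ (refineUnchosen l)
    terms-choice l =
      trans (cong (map _) (trans (selections-map _ (unchosen l)) (cong (map _) (selections-unchosen l))))
      (trans (map-map (λ _ → refl) _) (trans (sym (List.map-∘ (refineUnchosen l)))
        (List.map-cong-local (All.map (λ {m} l≡ → cong (termid⊗Δ-with m) (sym l≡)) (refineUnchosen-parts l)))))
      where
      termid⊗Δ-with : Labelling → TAG → TripleTAG
      termid⊗Δ-with m γ = γ , contract γ (middleEdges m) , contract (contract γ (middleEdges m)) (contract γ (rightEdges m))

module LinearCombinations {c ℓ} (K : CommutativeRing c ℓ) where

  open import Level using (_⊔_)

  open CommutativeRing K using (Carrier; _≈_; _+_; _*_; 0#; 1#; *-cong; zeroˡ; zeroʳ; distribˡ; distribʳ)
    renaming (refl to ≈-refl; sym to ≈-sym)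
  open TAGAlgebra K using (FS; Eqv; refl′; sym′; trans′; cons′; swap′; merge′; zero′; ext; bilin; scale)

  sumOver : ∀ {A B : Set} → (Carrier → A → FS B) → FS A → FS B
  sumOver F = concatMap (λ (a , x) → F a x)

  scaleMap : ∀ {A B : Set} → Carrier → (A → B) → FS A → FS B
  scaleMap k h = map (λ (a , x) → k * a , h x)

  ext-sumOver : ∀ {B C : Set} (f : B → FS C) xs → ext f xs ≡ sumOver (λ a x → scaleMap a id (f x)) xs
  ext-sumOver f [] = refl
  ext-sumOver f ((k , x) ∷ xs) = cong (scale k (f x) ++_) (ext-sumOver f xs)

  bilin-sumOver : ∀ {B C D : Set} (f : B → C → D) xs ys → bilin f xs ys ≡ sumOver (λ a x → scaleMap a (f x) ys) xs
  bilin-sumOver f [] ys = refl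
  bilin-sumOver f ((a , x) ∷ xs) ys = cong (scaleMap a (f x) ys ++_) (bilin-sumOver f xs ys)

  sumOver-sumOver : ∀ {A B C : Set} (G : Carrier → B → FS C) (F : Carrier → A → FS B) xs →
                    sumOver G (sumOver F xs) ≡ sumOver (λ a x → sumOver G (F a x)) xs
  sumOver-sumOver G F [] = refl
  sumOver-sumOver G F ((a , x) ∷ xs) =
    trans (List.concatMap-++ _ (F a x) (sumOver F xs)) (cong (sumOver G (F a x) ++_) (sumOver-sumOver G F xs))

  sumOver-scaleMap : ∀ {A B C : Set} (G : Carrier → B → FS C) k (h : A → B) xs →
                     sumOver G (scaleMap k h xs) ≡ sumOver (λ a x → G (k * a) (h x)) xs
  sumOver-scaleMap G k h [] = refl
  sumOver-scaleMap G k h ((a , x) ∷ xs) = cong (G (k * a) (h x) ++_) (sumOver-scaleMap G k h xs)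

  map-sumOver : ∀ {A B C : Set} (f : Carrier × B → Carrier × C) (F : Carrier → A → FS B) xs →
                map f (sumOver F xs) ≡ sumOver (λ a x → map f (F a x)) xs
  map-sumOver f F [] = refl
  map-sumOver f F ((a , x) ∷ xs) = trans (List.map-++ f (F a x) (sumOver F xs)) (cong (map f (F a x) ++_) (map-sumOver f F xs))

  sumOver-cong-≡ : ∀ {A B : Set} {F G : Carrier → A → FS B} → (∀ a x → F a x ≡ G a x) → ∀ xs → sumOver F xs ≡ sumOver G xs
  sumOver-cong-≡ F≡G = List.concatMap-cong (λ (a , x) → F≡G a x)

  module Congruence {B : Set} (R : B → B → Set) (R-refl : ∀ {x} → R x x) where

    Eqv-setoid : Setoid c (c ⊔ ℓ)
    Eqv-setoid = record { Carrier = FS B ; _≈_ = Eqv R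
                        ; isEquivalence = record { refl = refl′ ; sym = sym′ ; trans = trans′ } }

    module Reasoning = Relation.Binary.Reasoning.Setoid Eqv-setoid

    SameTerm : Carrier × B → Carrier × B → Set ℓ
    SameTerm (a , x) (a' , x') = a ≈ a' × R x x'

    Pointwise⇒Eqv : ∀ {xs ys} → Pointwise SameTerm xs ys → Eqv R xs ys
    Pointwise⇒Eqv [] = refl′
    Pointwise⇒Eqv ((a≈ , x~) ∷ ps) = cons′ a≈ x~ (Pointwise⇒Eqv ps)

    ≡⇒Eqv : ∀ {xs ys} → xs ≡ ys → Eqv R xs ys
    ≡⇒Eqv refl = refl′

    ↭⇒Eqv : ∀ {xs ys} → xs ↭ ys → Eqv R xs ys
    ↭⇒Eqv ↭.refl = refl′
    ↭⇒Eqv (prep x p) = cons′ ≈-refl R-refl (↭⇒Eqv p)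
    ↭⇒Eqv (swap x y p) = trans′ swap′ (cons′ ≈-refl R-refl (cons′ ≈-refl R-refl (↭⇒Eqv p)))
    ↭⇒Eqv (↭.trans p q) = trans′ (↭⇒Eqv p) (↭⇒Eqv q)

    ++⁺ˡ : ∀ zs {xs ys} → Eqv R xs ys → Eqv R (zs ++ xs) (zs ++ ys)
    ++⁺ˡ [] xs~ys = xs~ys
    ++⁺ˡ (z ∷ zs) xs~ys = cons′ ≈-refl R-refl (++⁺ˡ zs xs~ys)

    ++⁺ʳ : ∀ zs {xs ys} → Eqv R xs ys → Eqv R (xs ++ zs) (ys ++ zs)
    ++⁺ʳ zs refl′ = refl′
    ++⁺ʳ zs (sym′ e) = sym′ (++⁺ʳ zs e)
    ++⁺ʳ zs (trans′ e f) = trans′ (++⁺ʳ zs e) (++⁺ʳ zs f)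
    ++⁺ʳ zs (cons′ p q e) = cons′ p q (++⁺ʳ zs e)
    ++⁺ʳ zs swap′ = swap′
    ++⁺ʳ zs merge′ = merge′
    ++⁺ʳ zs zero′ = zero′

    ++⁺ : ∀ {xs ys zs ws} → Eqv R xs ys → Eqv R zs ws → Eqv R (xs ++ zs) (ys ++ ws)
    ++⁺ {ys = ys} {zs = zs} xs~ys zs~ws = trans′ (++⁺ʳ zs xs~ys) (++⁺ˡ ys zs~ws)

    zeros⇒Eqv-[] : ∀ {xs} → All (λ (a , _) → a ≈ 0#) xs → Eqv R xs []
    zeros⇒Eqv-[] [] = refl′
    zeros⇒Eqv-[] (a≈0 ∷ ps) = trans′ (cons′ a≈0 R-refl refl′) (trans′ zero′ (zeros⇒Eqv-[] ps))

    scaleMap-cong : ∀ {A : Set} {R₀ : A → A → Set} {h : A → B} k → (∀ {x y} → R₀ x y → R (h x) (h y)) →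
                    ∀ {xs ys} → Eqv R₀ xs ys → Eqv R (scaleMap k h xs) (scaleMap k h ys)
    scaleMap-cong k h-resp refl′ = refl′
    scaleMap-cong k h-resp (sym′ e) = sym′ (scaleMap-cong k h-resp e)
    scaleMap-cong k h-resp (trans′ e f) = trans′ (scaleMap-cong k h-resp e) (scaleMap-cong k h-resp f)
    scaleMap-cong k h-resp (cons′ p q e) = cons′ (*-cong ≈-refl p) (h-resp q) (scaleMap-cong k h-resp e)
    scaleMap-cong k h-resp swap′ = swap′
    scaleMap-cong k h-resp (merge′ {a} {a'}) = trans′ merge′ (cons′ (≈-sym (distribˡ k a a')) R-refl refl′)
    scaleMap-cong k h-resp zero′ = trans′ (cons′ (zeroʳ k) R-refl refl′) zero′

    scaleMap-+ : ∀ {A : Set} (h : A → B) a a' xs → Eqv R (scaleMap a h xs ++ scaleMap a' h xs) (scaleMap (a + a') h xs)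
    scaleMap-+ h a a' [] = refl′
    scaleMap-+ h a a' ((x , y) ∷ xs) =
      trans′ (cons′ ≈-refl R-refl (↭⇒Eqv (↭.shift (a' * x , h y) (scaleMap a h xs) (scaleMap a' h xs))))
        (trans′ merge′ (cons′ (≈-sym (distribʳ x a a')) R-refl (scaleMap-+ h a a' xs)))

    scaleMap-0 : ∀ {A : Set} (h : A → B) xs → Eqv R (scaleMap 0# h xs) []
    scaleMap-0 h xs = zeros⇒Eqv-[] (All.map⁺ (All.tabulate (λ {(x , _)} _ → zeroˡ x)))

    sumOver-cong : ∀ {A : Set} {R₀ : A → A → Set} (F : Carrier → A → FS B) →
      (∀ {a a' x x'} → a ≈ a' → R₀ x x' → Eqv R (F a x) (F a' x')) →
      (∀ {a a' x} → Eqv R (F a x ++ F a' x) (F (a + a') x)) →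
      (∀ {x} → Eqv R (F 0# x) []) →
      ∀ {xs ys} → Eqv R₀ xs ys → Eqv R (sumOver F xs) (sumOver F ys)
    sumOver-cong F F-cong F-+ F-0 refl′ = refl′
    sumOver-cong F F-cong F-+ F-0 (sym′ e) = sym′ (sumOver-cong F F-cong F-+ F-0 e)
    sumOver-cong F F-cong F-+ F-0 (trans′ e f) = trans′ (sumOver-cong F F-cong F-+ F-0 e) (sumOver-cong F F-cong F-+ F-0 f)
    sumOver-cong F F-cong F-+ F-0 (cons′ p q e) = ++⁺ (F-cong p q) (sumOver-cong F F-cong F-+ F-0 e)
    sumOver-cong F F-cong F-+ F-0 (swap′ {a , x} {a' , x'}) = ↭⇒Eqv (↭.shifts (F a x) (F a' x'))
    sumOver-cong F F-cong F-+ F-0 (merge′ {a} {a'} {x} {xs}) =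
      trans′ (≡⇒Eqv (sym (List.++-assoc (F a x) (F a' x) (sumOver F xs)))) (++⁺ʳ (sumOver F xs) F-+)
    sumOver-cong F F-cong F-+ F-0 (zero′ {x} {xs}) = ++⁺ʳ (sumOver F xs) F-0

    sumOver-cong-summands : ∀ {A : Set} (F G : Carrier → A → FS B) → (∀ a x → Eqv R (F a x) (G a x)) →
                            ∀ xs → Eqv R (sumOver F xs) (sumOver G xs)
    sumOver-cong-summands F G F~G [] = refl′
    sumOver-cong-summands F G F~G ((a , x) ∷ xs) = ++⁺ (F~G a x) (sumOver-cong-summands F G F~G xs)

module RingIdentities {c ℓ} (K : CommutativeRing c ℓ) where

  open import Tactic.RingSolver using (solve-∀)
  open import Tactic.RingSolver.Core.AlmostCommutativeRing using (AlmostCommutativeRing; fromCommutativeRing)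
  open import Data.Maybe using (nothing)

  almostCommutativeRing : AlmostCommutativeRing c ℓ
  almostCommutativeRing = fromCommutativeRing K (λ _ → nothing)

  open AlmostCommutativeRing almostCommutativeRing

  xy∙zw+xz∙v≈xz∙[yw+v] : ∀ x y z w v → (x * y) * (z * w) + (x * z) * v ≈ (x * z) * (y * w + v)
  xy∙zw+xz∙v≈xz∙[yw+v] = solve-∀ almostCommutativeRing

module Laws {c ℓ} (K : CommutativeRing c ℓ) where

  open CommutativeRing K using (Carrier; _≈_; _+_; _*_; 0#; 1#; reflexive; +-cong; *-cong; *-assoc;
    +-assoc; +-identityˡ; +-identityʳ; *-identityˡ; *-identityʳ; zeroˡ; zeroʳ; distribʳ; +-commutativeSemigroup)
    renaming (refl to ≈-refl; sym to ≈-sym; trans to ≈-trans)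
  open import Algebra.Properties.CommutativeSemigroup +-commutativeSemigroup using (x∙yz≈y∙xz)
  open RingIdentities K using (xy∙zw+xz∙v≈xz∙[yw+v])
  open TAGAlgebra K
  open LinearCombinations K
  open Graphs

  module C₁ = Congruence R₁ ≅-refl
  module C₂ = Congruence R₂ (≅-refl , ≅-refl)
  module C₃ = Congruence R₃ (≅-refl , ≅-refl , ≅-refl)

  m-cong : ∀ {x x' y y'} → x ∼₁ x' → y ∼₁ y' → m x y ∼₁ m x' y'
  m-cong {x} {x'} {y} {y'} x∼x' y∼y' = begin
    m x y                                     ≡⟨ bilin-sumOver _⊔ᵀ_ x y ⟩
    sumOver (λ a b → scaleMap a (b ⊔ᵀ_) y) x  ≈⟨ C₁.sumOver-cong _ (λ a≈ b≅ → C₁.Pointwise⇒Eqv (scaleMap-⊔ᵀ-pointwise a≈ b≅ y))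
                                                   (C₁.scaleMap-+ _ _ _ y) (C₁.scaleMap-0 _ y) x∼x' ⟩
    sumOver (λ a b → scaleMap a (b ⊔ᵀ_) y) x' ≈⟨ C₁.sumOver-cong-summands _ _
                                                   (λ a b → C₁.scaleMap-cong a (⊔ᵀ-cong ≅-refl) y∼y') x' ⟩
    sumOver (λ a b → scaleMap a (b ⊔ᵀ_) y') x' ≡⟨ bilin-sumOver _⊔ᵀ_ x' y' ⟨
    m x' y'                                   ∎
    where
    open C₁.Reasoning
    scaleMap-⊔ᵀ-pointwise : ∀ {a a' b b'} → a ≈ a' → b ≅ b' → ∀ ys →
                            Pointwise C₁.SameTerm (scaleMap a (b ⊔ᵀ_) ys) (scaleMap a' (b' ⊔ᵀ_) ys)
    scaleMap-⊔ᵀ-pointwise a≈ b≅ [] = []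
    scaleMap-⊔ᵀ-pointwise a≈ b≅ (_ ∷ ys) = (*-cong a≈ ≈-refl , ⊔ᵀ-cong b≅ ≅-refl) ∷ scaleMap-⊔ᵀ-pointwise a≈ b≅ ys

  Δterm : TAG × TAG → Carrier × (TAG × TAG)
  Δterm σ = 1# , coproductTerm σ

  Δ-cong : ∀ {x x'} → x ∼₁ x' → Δ x ∼₂ Δ x'
  Δ-cong {x} {x'} x∼x' = begin
    Δ x                                          ≡⟨ ext-sumOver Δᵇ x ⟩
    sumOver (λ a b → scaleMap a id (Δᵇ b)) x     ≈⟨ C₂.sumOver-cong _
                                                      (λ a≈ b≅ → C₂.Pointwise⇒Eqv (Δterms-pointwise a≈ (selections-≅ b≅)))
                                                      (C₂.scaleMap-+ _ _ _ _) (C₂.scaleMap-0 _ _) x∼x' ⟩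
    sumOver (λ a b → scaleMap a id (Δᵇ b)) x'    ≡⟨ ext-sumOver Δᵇ x' ⟨
    Δ x'                                         ∎
    where
    open C₂.Reasoning
    Δterms-pointwise : ∀ {a a' σs σs'} → a ≈ a' → Pointwise SelectionIso σs σs' →
                       Pointwise C₂.SameTerm (scaleMap a id (map Δterm σs)) (scaleMap a' id (map Δterm σs'))
    Δterms-pointwise a≈ [] = []
    Δterms-pointwise a≈ (σ≅ ∷ σs≅) = (*-cong a≈ ≈-refl , σ≅) ∷ Δterms-pointwise a≈ σs≅

  εᵇ-cong : ∀ {Γ Γ'} → Γ ≅ Γ' → εᵇ Γ ≡ εᵇ Γ'
  εᵇ-cong (_ , _ , [] , _) = refl
  εᵇ-cong (_ , _ , _ ∷ _ , _) = refl

  ε-cong : ∀ {x x'} → x ∼₁ x' → ε x ≈ ε x'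
  ε-cong refl′ = ≈-refl
  ε-cong (sym′ e) = ≈-sym (ε-cong e)
  ε-cong (trans′ e f) = ≈-trans (ε-cong e) (ε-cong f)
  ε-cong (cons′ a≈ b≅ e) = +-cong (*-cong a≈ (reflexive (εᵇ-cong b≅))) (ε-cong e)
  ε-cong (swap′ {a , b} {a' , b'} {xs}) = x∙yz≈y∙xz (a * εᵇ b) (a' * εᵇ b') (ε xs)
  ε-cong (merge′ {a} {a'} {b} {xs}) = ≈-trans (≈-sym (+-assoc _ _ _)) (+-cong (≈-sym (distribʳ (εᵇ b) a a')) ≈-refl)
  ε-cong (zero′ {b} {xs}) = ≈-trans (+-cong (zeroˡ (εᵇ b)) ≈-refl) (+-identityˡ (ε xs))

  m-assoc : ∀ x y z → m (m x y) z ∼₁ m x (m y z)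
  m-assoc x y z = begin
    m (m x y) z
      ≡⟨ trans (bilin-sumOver _⊔ᵀ_ (m x y) z) (trans (cong (sumOver (times z)) (bilin-sumOver _⊔ᵀ_ x y))
           (trans (sumOver-sumOver (times z) (times y) x) (sumOver-cong-≡ (λ a b → sumOver-scaleMap (times z) a (b ⊔ᵀ_) y) x))) ⟩
    sumOver (λ a b → sumOver (λ a' b' → scaleMap (a * a') ((b ⊔ᵀ b') ⊔ᵀ_) z) y) x
      ≈⟨ C₁.sumOver-cong-summands _ _ (λ a b →
           C₁.sumOver-cong-summands _ _ (λ a' b' → C₁.Pointwise⇒Eqv (assoc-pointwise a a' b b' z)) y) x ⟩
    sumOver (λ a b → sumOver (λ a' b' → scaleMap a (b ⊔ᵀ_) (scaleMap a' (b' ⊔ᵀ_) z)) y) x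
      ≡⟨ trans (bilin-sumOver _⊔ᵀ_ x (m y z))
           (sumOver-cong-≡ (λ a b → trans (cong (scaleMap a (b ⊔ᵀ_)) (bilin-sumOver _⊔ᵀ_ y z)) (map-sumOver _ (times z) y)) x) ⟨
    m x (m y z) ∎
    where
    open C₁.Reasoning
    times : H → Carrier → TAG → H
    times w a b = scaleMap a (b ⊔ᵀ_) w
    assoc-pointwise : ∀ a a' b b' zs →
      Pointwise C₁.SameTerm (scaleMap (a * a') ((b ⊔ᵀ b') ⊔ᵀ_) zs) (scaleMap a (b ⊔ᵀ_) (scaleMap a' (b' ⊔ᵀ_) zs))
    assoc-pointwise a a' b b' [] = []
    assoc-pointwise a a' b b' ((a'' , b'') ∷ zs) = (*-assoc a a' a'' , ⊔ᵀ-assoc b b' b'') ∷ assoc-pointwise a a' b b' zs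

  m-unitˡ : ∀ x → m 1H x ∼₁ x
  m-unitˡ x = trans′ (C₁.≡⇒Eqv (List.++-identityʳ (scaleMap 1# ([] ⊔ᵀ_) x))) (C₁.Pointwise⇒Eqv (unit-pointwise x))
    where
    unit-pointwise : ∀ x → Pointwise C₁.SameTerm (scaleMap 1# ([] ⊔ᵀ_) x) x
    unit-pointwise [] = []
    unit-pointwise ((a , b) ∷ x) = (*-identityˡ a , ≡⇒≅ (⊔ᵀ-identityˡ b)) ∷ unit-pointwise x

  m-unitʳ : ∀ x → m x 1H ∼₁ x
  m-unitʳ [] = refl′
  m-unitʳ ((a , b) ∷ x) = cons′ (*-identityʳ a) (≡⇒≅ (List.++-identityʳ b)) (m-unitʳ x)

  εᵇ-nonempty : ∀ Γ → null Γ ≡ false → εᵇ Γ ≡ 0#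
  εᵇ-nonempty (_ ∷ _) _ = refl

  map-Δ∼id : ∀ (φ : Carrier × (TAG × TAG) → Carrier × TAG) →
          (∀ a b → map φ (scaleMap a id (Δᵇ b)) ∼₁ [ (a , b) ]) → ∀ x → map φ (Δ x) ∼₁ x
  map-Δ∼id φ φ-basis x = trans′ (C₁.≡⇒Eqv (trans (cong (map φ) (ext-sumOver Δᵇ x)) (map-sumOver φ _ x))) (sum-basis x)
    where
    sum-basis : ∀ x → sumOver (λ a b → map φ (scaleMap a id (Δᵇ b))) x ∼₁ x
    sum-basis [] = refl′
    sum-basis ((a , b) ∷ x) = C₁.++⁺ (φ-basis a b) (sum-basis x)

  counitˡ : ∀ x → ε⊗id (Δ x) ∼₁ x
  counitˡ = map-Δ∼id _ basis
    where
    basis : ∀ a b → ε⊗id (scaleMap a id (Δᵇ b)) ∼₁ [ (a , b) ]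
    basis a b with selections-last b
    ... | σs , sel≡ , σs-nonempty = begin
      ε⊗id (scaleMap a id (Δᵇ b))
        ≡⟨ trans (cong ε⊗id (map-map (λ _ → refl) (selections b))) (map-map (λ _ → refl) (selections b)) ⟩
      map term (selections b)
        ≡⟨ trans (cong (map term) sel≡) (List.map-++ term σs _) ⟩
      map term σs ++ [ term ([] , b) ]
        ≈⟨ C₁.++⁺ (C₁.zeros⇒Eqv-[] (All.map⁺ {f = term} (All.map (λ {σ} → vanishes {σ}) σs-nonempty)))
                  (cons′ (≈-trans (*-identityʳ _) (*-identityʳ a)) (≡⇒≅ (contract-[] b)) refl′) ⟩
      [ (a , b) ] ∎
      where
      open C₁.Reasoning
      term : TAG × TAG → Carrier × TAG
      term (s , r) = (a * 1#) * εᵇ s , contract s r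
      vanishes : ∀ {σ} → null (proj₁ σ) ≡ false → proj₁ (term σ) ≈ 0#
      vanishes {σ} nonempty = ≈-trans (*-cong ≈-refl (reflexive (εᵇ-nonempty (proj₁ σ) nonempty))) (zeroʳ _)

  counitʳ : ∀ x → id⊗ε (Δ x) ∼₁ x
  counitʳ = map-Δ∼id _ basis
    where
    basis : ∀ a b → id⊗ε (scaleMap a id (Δᵇ b)) ∼₁ [ (a , b) ]
    basis a b with selections-first b
    ... | σs , sel≡ , σs-nonempty = begin
      id⊗ε (scaleMap a id (Δᵇ b))
        ≡⟨ trans (cong id⊗ε (map-map (λ _ → refl) (selections b))) (map-map (λ _ → refl) (selections b)) ⟩
      map term (selections b)
        ≡⟨ cong (map term) sel≡ ⟩
      term (b , []) ∷ map term σs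
        ≈⟨ cons′ (≈-trans (*-identityʳ _) (*-identityʳ a)) ≅-refl
                 (C₁.zeros⇒Eqv-[] (All.map⁺ {f = term} (All.map (λ {σ} → vanishes {σ}) σs-nonempty))) ⟩
      [ (a , b) ] ∎
      where
      open C₁.Reasoning
      term : TAG × TAG → Carrier × TAG
      term (s , r) = (a * 1#) * εᵇ (contract s r) , s
      vanishes : ∀ {σ} → null (proj₂ σ) ≡ false → proj₁ (term σ) ≈ 0#
      vanishes {s , r} nonempty =
        ≈-trans (*-cong ≈-refl (reflexive (εᵇ-nonempty (contract s r) (trans (null-map _ r) nonempty)))) (zeroʳ _)

  ε-unit : ε 1H ≈ 1#
  ε-unit = ≈-trans (+-identityʳ _) (*-identityʳ 1#)

  Δ-unit : Δ 1H ∼₂ 1H⊗1H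
  Δ-unit = cons′ (*-identityʳ 1#) (≅-refl , ≅-refl) refl′

  ε-++ : ∀ xs ys → ε (xs ++ ys) ≈ ε xs + ε ys
  ε-++ [] ys = ≈-sym (+-identityˡ _)
  ε-++ ((a , b) ∷ xs) ys = ≈-trans (+-cong ≈-refl (ε-++ xs ys)) (≈-sym (+-assoc _ _ _))

  εᵇ-⊔ᵀ : ∀ b d → εᵇ (b ⊔ᵀ d) ≈ εᵇ b * εᵇ d
  εᵇ-⊔ᵀ [] d = ≈-trans (reflexive (cong εᵇ (⊔ᵀ-identityˡ d))) (≈-sym (*-identityˡ _))
  εᵇ-⊔ᵀ (_ ∷ _) d = ≈-sym (zeroˡ _)

  ε-scaleMap-⊔ᵀ : ∀ a b ys → ε (scaleMap a (b ⊔ᵀ_) ys) ≈ (a * εᵇ b) * ε ys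
  ε-scaleMap-⊔ᵀ a b [] = ≈-sym (zeroʳ _)
  ε-scaleMap-⊔ᵀ a b ((a' , d) ∷ ys) =
    ≈-trans (+-cong (*-cong ≈-refl (εᵇ-⊔ᵀ b d)) (ε-scaleMap-⊔ᵀ a b ys)) (xy∙zw+xz∙v≈xz∙[yw+v] a a' (εᵇ b) (εᵇ d) (ε ys))

  ε-mult : ∀ x y → ε (m x y) ≈ ε x * ε y
  ε-mult x y = ≈-trans (reflexive (cong ε (bilin-sumOver _⊔ᵀ_ x y))) (ε-sum x)
    where
    ε-sum : ∀ x → ε (sumOver (λ a b → scaleMap a (b ⊔ᵀ_) y) x) ≈ ε x * ε y
    ε-sum [] = ≈-sym (zeroˡ _)
    ε-sum ((a , b) ∷ x) = ≈-trans (ε-++ (scaleMap a (b ⊔ᵀ_) y) _)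
      (≈-trans (+-cong (ε-scaleMap-⊔ᵀ a b y) (ε-sum x)) (≈-sym (distribʳ (ε y) (a * εᵇ b) (ε x))))

  Δᵇ-⊔ᵀ : ∀ a a' b b' → scaleMap (a * a') id (Δᵇ (b ⊔ᵀ b')) ∼₂
                         sumOver (λ a₁ σ → scaleMap (a * a₁) (zip′ _⊔ᵀ_ _⊔ᵀ_ σ) (scaleMap a' id (Δᵇ b'))) (Δᵇ b)
  Δᵇ-⊔ᵀ a a' b b' = begin
    scaleMap (a * a') id (Δᵇ (b ⊔ᵀ b'))
      ≡⟨ trans (map-map (λ _ → refl) (selections (b ⊔ᵀ b')))
        (trans (cong (map _) (trans (selections-++ b (shift N b'))
                                    (cong (cartesianProductWith _ (selections b)) (selections-map _ b'))))
        (trans (map-cartesianProductWith _ _ (selections b) _) (cartesianProductWith-mapʳ _ _ (selections b) (selections b')))) ⟩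
    cartesianProductWith (λ σ τ → (a * a') * 1# , coproductTerm (zip′ _++_ _++_ σ (Product.map (shift N) (shift N) τ)))
                         (selections b) (selections b')
      ≈⟨ C₂.Pointwise⇒Eqv (cartesianProductWith-pointwise _ _ (selections b') (selections-All (VerticesBelow-bound b))
           (λ {(s₁ , r₁)} (s₁-below , r₁-below) (s₂ , r₂) →
              ≈-trans (*-identityʳ _) (≈-sym (*-cong (*-identityʳ a) (*-identityʳ a'))) ,
              coproductTerm-⊔ᵀ s₁ s₂ s₁-below r₁ r₂ r₁-below)) ⟩
    cartesianProductWith (λ σ τ → (a * 1#) * (a' * 1#) , zip′ _⊔ᵀ_ _⊔ᵀ_ (coproductTerm σ) (coproductTerm τ))
                         (selections b) (selections b')
      ≡⟨ sum-Δᵇ (selections b) ⟨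
    sumOver (λ a₁ σ → scaleMap (a * a₁) (zip′ _⊔ᵀ_ _⊔ᵀ_ σ) (scaleMap a' id (Δᵇ b'))) (Δᵇ b) ∎
    where
    open C₂.Reasoning
    N = bound b
    sum-Δᵇ : ∀ σs → sumOver (λ a₁ σ → scaleMap (a * a₁) (zip′ _⊔ᵀ_ _⊔ᵀ_ σ) (scaleMap a' id (Δᵇ b'))) (map Δterm σs) ≡
      cartesianProductWith (λ σ τ → (a * 1#) * (a' * 1#) , zip′ _⊔ᵀ_ _⊔ᵀ_ (coproductTerm σ) (coproductTerm τ)) σs (selections b')
    sum-Δᵇ [] = refl
    sum-Δᵇ (σ ∷ σs) = cong₂ _++_ (trans (map-map (λ _ → refl) _) (map-map (λ _ → refl) (selections b'))) (sum-Δᵇ σs)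

  Δ-mult : ∀ x y → Δ (m x y) ∼₂ m₂ (Δ x) (Δ y)
  Δ-mult x y = begin
    Δ (m x y)
      ≡⟨ trans (ext-sumOver Δᵇ (m x y)) (trans (cong (sumOver Δ-scaled) (bilin-sumOver _⊔ᵀ_ x y))
           (trans (sumOver-sumOver Δ-scaled (λ a b → scaleMap a (b ⊔ᵀ_) y) x)
                  (sumOver-cong-≡ (λ a b → sumOver-scaleMap Δ-scaled a (b ⊔ᵀ_) y) x))) ⟩
    sumOver (λ a b → sumOver (λ a' b' → scaleMap (a * a') id (Δᵇ (b ⊔ᵀ b'))) y) x
      ≈⟨ C₂.sumOver-cong-summands _ _ Δ-basis-times x ⟩
    sumOver (λ a b → sumOver (λ a₁ σ → times-Δy (a * a₁) σ) (Δᵇ b)) x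
      ≡⟨ trans (bilin-sumOver _ (Δ x) (Δ y)) (trans (cong (sumOver times-Δy) (ext-sumOver Δᵇ x))
           (trans (sumOver-sumOver times-Δy Δ-scaled x) (sumOver-cong-≡ (λ a b → sumOver-scaleMap times-Δy a id (Δᵇ b)) x))) ⟨
    m₂ (Δ x) (Δ y) ∎
    where
    open C₂.Reasoning
    Δ-scaled : Carrier → TAG → H⊗H
    Δ-scaled a b = scaleMap a id (Δᵇ b)
    times-Δy : Carrier → TAG × TAG → H⊗H
    times-Δy a σ = scaleMap a (zip′ _⊔ᵀ_ _⊔ᵀ_ σ) (Δ y)
    Δ-basis-times : ∀ a b → sumOver (λ a' b' → scaleMap (a * a') id (Δᵇ (b ⊔ᵀ b'))) y ∼₂
                            sumOver (λ a₁ σ → times-Δy (a * a₁) σ) (Δᵇ b)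
    Δ-basis-times a b = begin
      sumOver (λ a' b' → scaleMap (a * a') id (Δᵇ (b ⊔ᵀ b'))) y
        ≈⟨ C₂.sumOver-cong-summands _ _ (λ a' b' → Δᵇ-⊔ᵀ a a' b b') y ⟩
      sumOver (λ a' b' → sumOver (λ a₁ σ → scaleMap (a * a₁) (zip′ _⊔ᵀ_ _⊔ᵀ_ σ) (Δ-scaled a' b')) (Δᵇ b)) y
        ≈⟨ C₂.↭⇒Eqv (concatMap-comm-↭ _ y (Δᵇ b)) ⟩
      sumOver (λ a₁ σ → sumOver (λ a' b' → scaleMap (a * a₁) (zip′ _⊔ᵀ_ _⊔ᵀ_ σ) (Δ-scaled a' b')) y) (Δᵇ b)
        ≡⟨ sumOver-cong-≡ (λ a₁ σ → trans (cong (scaleMap (a * a₁) _) (ext-sumOver Δᵇ y)) (map-sumOver _ Δ-scaled y)) (Δᵇ b) ⟨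
      sumOver (λ a₁ σ → times-Δy (a * a₁) σ) (Δᵇ b) ∎

  Δ⊗idᵇ id⊗Δᵇ : TAG × TAG → H⊗H⊗H
  Δ⊗idᵇ (Γ₁ , Γ₂) = map (λ (a , (x , y)) → a , (x , (y , Γ₂))) (Δᵇ Γ₁)
  id⊗Δᵇ (Γ₁ , Γ₂) = map (λ (a , p) → a , (Γ₁ , p)) (Δᵇ Γ₂)

  Δ⊗id-Δᵇ : ∀ a b → sumOver (λ a₁ σ → scaleMap (a * a₁) id (Δ⊗idᵇ σ)) (Δᵇ b) ≡ map ((a * 1#) * 1# ,_) (termsΔ⊗id b)
  Δ⊗id-Δᵇ a b = sum-terms (selections b)
    where
    terms : TAG × TAG → List TripleTAG
    terms (γ , rest) = map (λ (x , y) → x , contract x y , contract γ rest) (selections γ)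
    scaled-terms : ∀ σ τs → scaleMap (a * 1#) id (map (λ (c , (x , y)) → c , (x , (y , proj₂ (coproductTerm σ)))) (map Δterm τs)) ≡
                        map ((a * 1#) * 1# ,_) (map (λ (x , y) → x , contract x y , proj₂ (coproductTerm σ)) τs)
    scaled-terms σ [] = refl
    scaled-terms σ (τ ∷ τs) = cong (_ ∷_) (scaled-terms σ τs)
    sum-terms : ∀ σs → sumOver (λ a₁ σ → scaleMap (a * a₁) id (Δ⊗idᵇ σ)) (map Δterm σs) ≡ map ((a * 1#) * 1# ,_) (concatMap terms σs)
    sum-terms [] = refl
    sum-terms (σ ∷ σs) = trans (cong₂ _++_ (scaled-terms σ (selections (proj₁ σ))) (sum-terms σs)) (sym (List.map-++ _ (terms σ) _))

  id⊗Δ-Δᵇ : ∀ a b → sumOver (λ a₁ σ → scaleMap (a * a₁) id (id⊗Δᵇ σ)) (Δᵇ b) ≡ map ((a * 1#) * 1# ,_) (termsid⊗Δ b)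
  id⊗Δ-Δᵇ a b = sum-terms (selections b)
    where
    terms : TAG × TAG → List TripleTAG
    terms (γ , rest) = map (λ (x , y) → γ , x , contract x y) (selections (contract γ rest))
    scaled-terms : ∀ σ τs → scaleMap (a * 1#) id (map (λ (c , p) → c , (proj₁ σ , p)) (map Δterm τs)) ≡
                        map ((a * 1#) * 1# ,_) (map (λ (x , y) → proj₁ σ , x , contract x y) τs)
    scaled-terms σ [] = refl
    scaled-terms σ (τ ∷ τs) = cong (_ ∷_) (scaled-terms σ τs)
    sum-terms : ∀ σs → sumOver (λ a₁ σ → scaleMap (a * a₁) id (id⊗Δᵇ σ)) (map Δterm σs) ≡ map ((a * 1#) * 1# ,_) (concatMap terms σs)
    sum-terms [] = refl
    sum-terms (σ ∷ σs) = trans (cong₂ _++_ (scaled-terms σ (selections (contract (proj₁ σ) (proj₂ σ)))) (sum-terms σs))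
                        (sym (List.map-++ _ (terms σ) _))

  coassoc-basis : ∀ a b → sumOver (λ a₁ σ → scaleMap (a * a₁) id (Δ⊗idᵇ σ)) (Δᵇ b) ∼₃
                          sumOver (λ a₁ σ → scaleMap (a * a₁) id (id⊗Δᵇ σ)) (Δᵇ b)
  coassoc-basis a b = begin
    sumOver (λ a₁ σ → scaleMap (a * a₁) id (Δ⊗idᵇ σ)) (Δᵇ b)
      ≡⟨ trans (Δ⊗id-Δᵇ a b) (cong (map (κ ,_)) (termsΔ⊗id-labellings b)) ⟩
    map (κ ,_) (map termΔ⊗id (concatMap refineChosen (choices b)))
      ≈⟨ C₃.↭⇒Eqv (↭.map⁺ _ (↭.map⁺ termΔ⊗id (refineChosen-↭ b))) ⟩
    map (κ ,_) (map termΔ⊗id (labellings b))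
      ≈⟨ C₃.Pointwise⇒Eqv (Pointwise.map⁺ _ _ (Pointwise.map⁺ _ _
           (Pointwise.refl (λ {m} → ≈-refl , ≅-refl , ≅-refl , termΔ⊗id-≅-termid⊗Δ m)))) ⟩
    map (κ ,_) (map termid⊗Δ (labellings b))
      ≈⟨ C₃.↭⇒Eqv (↭.map⁺ _ (↭.map⁺ termid⊗Δ (↭.↭-sym (refineUnchosen-↭ b)))) ⟩
    map (κ ,_) (map termid⊗Δ (concatMap refineUnchosen (choices b)))
      ≡⟨ trans (id⊗Δ-Δᵇ a b) (cong (map (κ ,_)) (termsid⊗Δ-labellings b)) ⟨
    sumOver (λ a₁ σ → scaleMap (a * a₁) id (id⊗Δᵇ σ)) (Δᵇ b) ∎
    where
    open C₃.Reasoning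
    κ : Carrier
    κ = (a * 1#) * 1#

  Δ-coassoc : ∀ x → Δ⊗id (Δ x) ∼₃ id⊗Δ (Δ x)
  Δ-coassoc x = begin
    Δ⊗id (Δ x)
      ≡⟨ expand Δ⊗idᵇ ⟩
    sumOver (λ a b → sumOver (λ a₁ σ → scaleMap (a * a₁) id (Δ⊗idᵇ σ)) (Δᵇ b)) x
      ≈⟨ C₃.sumOver-cong-summands _ _ coassoc-basis x ⟩
    sumOver (λ a b → sumOver (λ a₁ σ → scaleMap (a * a₁) id (id⊗Δᵇ σ)) (Δᵇ b)) x
      ≡⟨ expand id⊗Δᵇ ⟨
    id⊗Δ (Δ x) ∎
    where
    open C₃.Reasoning
    expand : ∀ (f : TAG × TAG → H⊗H⊗H) → ext f (Δ x) ≡ sumOver (λ a b → sumOver (λ a₁ σ → scaleMap (a * a₁) id (f σ)) (Δᵇ b)) x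
    expand f = trans (ext-sumOver f (Δ x)) (trans (cong (sumOver _) (ext-sumOver Δᵇ x))
                 (trans (sumOver-sumOver _ _ x) (sumOver-cong-≡ (λ a b → sumOver-scaleMap _ a id (Δᵇ b)) x)))

  isBialgebra : IsBialgebra
  isBialgebra = record
    { m-cong = m-cong ; Δ-cong = Δ-cong ; ε-cong = ε-cong
    ; m-assoc = m-assoc ; m-unitˡ = m-unitˡ ; m-unitʳ = m-unitʳ
    ; Δ-coassoc = Δ-coassoc ; counitˡ = counitˡ ; counitʳ = counitʳ
    ; Δ-mult = Δ-mult ; Δ-unit = Δ-unit ; ε-mult = ε-mult ; ε-unit = ε-unit
    }

mainTheorem6 : ∀ {c ℓ} (K : CommutativeRing c ℓ) → IsField K → CharZero K →
                 TAGAlgebra.IsBialgebra K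
mainTheorem6 K _ _ = Laws.isBialgebra K
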